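{- Let $\mathbf{h}$ be a weakly increasing sequence of positive integers with $\mathbf{h}(i)>i$ for all $i$, let $S$ be a nonempty $\mathbf{h}$-admissible set, $m=\mathbf{m}(S)$, and $d_S=\#\{i\in[\mathbf{h}(m)]: i\le_S\mathbf{h}(m)\}$. Then the degree of the polynomial $\mathcal{I}_\mathbf{h}(S;n)$ is $\mathbf{h}(m)-d_S$.
   Context: $\mathcal{P}_\mathbf{h}=\{(i,j): i<j\le \mathbf{h}(i)\}$. For $\pi\in S_n$, $\mathrm{inv}_\mathbf{h}(\pi)=\{(i,j)\in\mathcal{P}_\mathbf{h}: j\le n,\ \pi_i>\pi_j\}$. $S$ is $\mathbf{h}$-admissible if $S=\mathrm{inv}_\mathbf{h}(\pi)$ for some permutation $\pi$. $\mathcal{I}_\mathbf{h}(S;n)$ denotes the polynomial in $n$ that equals $\#\{\pi\in S_n:\mathrm{inv}_\mathbf{h}(\pi)=S\}$ for all $n\ge\mathbf{j}(S)=\max\{j:(i,j)\in S\}$. $\mathbf{m}(S)=\max\{i:(i,i+1)\in S\}$. $\le_S$ is the partial order on $[\mathbf{h}(m)]$ generated by $i>_S j$ whenever $(i,j)\in S$, and $i<_S j$ whenever $(i,j)\in\mathcal{P}_\mathbf{h}\setminus S$ with $j\le\mathbf{h}(m)$. -}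

module Defs where

open import Data.Nat using (ℕ; zero; suc; _≤_; _<_; _⊔_; _≡ᵇ_)
open import Data.Bool using (if_then_else_)
open import Data.Integer using (+_)
open import Data.Rational using (ℚ; 0ℚ; _/_) renaming (_+_ to _+ℚ_; _*_ to _*ℚ_)
open import Data.Product using (Σ; ∃; _×_; _,_)
open import Data.List using (List; []; _∷_; map; upTo; length; foldr)
open import Data.List.Membership.Propositional using (_∈_; _∉_)
open import Data.List.Relation.Unary.Unique.Propositional using (Unique)
open import Data.List.Relation.Binary.Permutation.Propositional using (_↭_)
open import Data.Vec using (Vec)
import Data.Vec as V
open import Function.Bundles using (_⇔_)
open import Relation.Binary.Construct.Closure.ReflexiveTransitive using (Star)
open import Relation.Binary.PropositionalEquality using (_≡_)

-- All indices are 1-based positive integers, as in the paper.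

IsHSeq : (ℕ → ℕ) → Set
IsHSeq h = (∀ i j → 1 ≤ i → i ≤ j → h i ≤ h j) × (∀ i → 1 ≤ i → i < h i)

-- A finite set of pairs is represented by a list (duplicates irrelevant).
PairSet : Set
PairSet = List (ℕ × ℕ)

-- S_n : a permutation of [n] in one-line notation π₁ π₂ … πₙ
IsPerm : ℕ → List ℕ → Set
IsPerm n π = π ↭ map suc (upTo n)

-- 1-based entry π_i (0 outside the range, never used there)
at : List ℕ → ℕ → ℕ
at [] _ = 0
at (x ∷ xs) zero = 0
at (x ∷ xs) (suc zero) = x
at (x ∷ xs) (suc (suc i)) = at xs (suc i)

InP : (ℕ → ℕ) → ℕ → ℕ → Set
InP h i j = 1 ≤ i × i < j × j ≤ h i

InvH : (ℕ → ℕ) → ℕ → List ℕ → ℕ → ℕ → Set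
InvH h n π i j = InP h i j × j ≤ n × at π j < at π i

IsInvSet : (ℕ → ℕ) → ℕ → List ℕ → PairSet → Set
IsInvSet h n π S = ∀ i j → ((i , j) ∈ S) ⇔ InvH h n π i j

Admissible : (ℕ → ℕ) → PairSet → Set
Admissible h S = ∃ λ n → ∃ λ π → IsPerm n π × IsInvSet h n π S

Nonempty : PairSet → Set
Nonempty S = ∃ λ p → p ∈ S

jS : PairSet → ℕ
jS = foldr (λ { (i , j) r → j ⊔ r }) 0

mS : PairSet → ℕ
mS = foldr (λ { (i , j) r → if j ≡ᵇ suc i then i ⊔ r else r }) 0

HasCard : {A : Set} → (A → Set) → ℕ → Set
HasCard {A} P k = Σ (List A) λ L → Unique L × (∀ x → (x ∈ L) ⇔ P x) × length L ≡ k

-- Generating relation of ≤_S on [M], M = h(m):  Step i j means i <_S j.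
data Step (h : ℕ → ℕ) (S : PairSet) (M : ℕ) : ℕ → ℕ → Set where
  fromS    : ∀ {i j} → (j , i) ∈ S → Step h S M i j
  fromNotS : ∀ {i j} → InP h i j → (i , j) ∉ S → j ≤ M → Step h S M i j

_≤[_,_,_]_ : ℕ → (ℕ → ℕ) → PairSet → ℕ → ℕ → Set
i ≤[ h , S , M ] j = Star (Step h S M) i j

-- polynomial with rational coefficients c₀ + c₁ x + … (Horner evaluation)
evalPoly : ∀ {k} → Vec ℚ k → ℚ → ℚ
evalPoly c x = V.foldr _ (λ a acc → a +ℚ (x *ℚ acc)) 0ℚ c

ℕtoℚ : ℕ → ℚ
ℕtoℚ n = + n / 1

module Submission where

-- For n ≥ J = j(S), a permutation of [n + 1] with inversion set S is a permutation π of [n] with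
-- inversion set S followed by a new last value v (the other values standardised), where v has to exceed
-- every entry of π at a position i ≤ n with h(i) > n. If e(π) + 1 is the number of such v, the
-- extensions of π have e = 0, …, e(π), so by the hockey-stick identity
--   #{σ ∈ S_(J+t) : inv_h(σ) = S} = Σ_τ (t + e(τ) choose e(τ)),   τ ∈ S_J with inv_h(τ) = S,
-- a polynomial in n = J + t of degree max_τ e(τ). Extending never increases e and can always keep it,
-- so this maximum can be read off at level M = h(m), where e(σ) = M − σ_M because every position
-- beyond m lies below M in ≤_S. The d positions i ≤_S M carry distinct values at most σ_M, so σ_M ≥ d.
-- Conversely, while σ_M > d, moving the largest value y < σ_M that sits outside the down-set of M up
-- to σ_M, and the values in between down by one, keeps the inversion set and lowers σ_M by one.

open import Defs
open import Level using (0ℓ)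
open import Data.Nat using (ℕ; zero; suc; pred; _+_; _*_; _∸_; _≤_; _<_; _≤?_; _<?_; _≡ᵇ_; z≤n; s≤s; ≤′-refl; ≤′-step)
open import Data.Nat.Properties
open import Data.Nat.Combinatorics using (_C_; nCn≡1; nC1≡n; k>n⇒nCk≡0; nCk+nC[k+1]≡[n+1]C[k+1])
open import Data.Nat.ListAction using (sum)
open import Data.Nat.ListAction.Properties using (sum-++)
open import Data.Nat.Tactic.RingSolver using () renaming (solve-∀ to solve-∀ℕ)
open import Data.Nat.Coprimality using (1-coprimeTo)
import Data.Nat.Coprimality as Coprime
import Data.Integer as ℤ
import Data.Integer.Properties as ℤ
open import Data.Rational using (ℚ; 0ℚ; 1ℚ; mkℚ; toℚᵘ; 1/_; Positive; positive)
  renaming (_+_ to _+ℚ_; _-_ to _-ℚ_; _*_ to _*ℚ_; _<_ to _<ℚ_; _≤_ to _≤ℚ_)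
import Data.Rational.Properties as ℚ
import Data.Rational.Unnormalised as ℚᵘ
import Data.Rational.Unnormalised.Properties as ℚᵘ
open import Data.Bool using (true; false)
open import Data.Product using (∃; _×_; _,_; _,′_; proj₁; proj₂)
open import Data.Product.Properties using (≡-dec)
open import Data.Sum using (_⊎_; inj₁; inj₂)
open import Data.Empty using (⊥-elim)
open import Data.Vec using (Vec; tabulate; lookup)
open import Data.Vec.Properties using (lookup∘tabulate)
open import Data.Fin using (toℕ; fromℕ)
open import Data.Fin.Properties using (toℕ-fromℕ)
open import Data.List using (List; []; _∷_; _∷ʳ_; _++_; [_]; map; foldr; upTo; applyUpTo; length; filter; initLast; _∷ʳ′_)
open import Data.List.Properties
  using (length-map; length-upTo; ∷ʳ-injective; map-injective; map-∘; map-++; map-cong; map-cong-local; map-id-local;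
         map-upTo)
open import Data.List.Extrema.Nat using (max; max≤v⁺; xs≤max)
open import Data.List.Membership.Propositional using (_∈_; _∉_; find; lose)
open import Data.List.Membership.Propositional.Properties
  using (∈-map⁺; ∈-map⁻; ∈-++⁺ˡ; ∈-++⁺ʳ; ∈-++⁻; ∈-upTo⁺; ∈-upTo⁻; ∈-filter⁺; ∈-filter⁻)
open import Data.List.Membership.Propositional.Properties.WithK using (unique∧set⇒bag)
open import Data.List.Membership.DecPropositional _≟_ using () renaming (_∈?_ to _∈ℕ?_)
open import Data.List.Membership.DecPropositional (≡-dec _≟_ _≟_) using () renaming (_∈?_ to _∈ₚ?_)
open import Data.List.Relation.Unary.Any using (here; there; any?)
open import Data.List.Relation.Unary.All using (All; []; _∷_)
import Data.List.Relation.Unary.All as All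
open import Data.List.Relation.Unary.All.Properties using (All¬⇒¬Any; ++⁻)
import Data.List.Relation.Unary.All.Properties as All
open import Data.List.Relation.Unary.AllPairs using ([]; _∷_)
open import Data.List.Relation.Unary.Unique.Propositional using (Unique)
import Data.List.Relation.Unary.Unique.Propositional.Properties as Unique
open import Data.List.Relation.Binary.Permutation.Propositional using (↭-sym; ↭⇒↭ₛ)
open import Data.List.Relation.Binary.Permutation.Propositional.Properties using (∈-resp-↭; ↭-length)
import Data.List.Relation.Binary.Permutation.Setoid.Properties as Permutationₛ
open import Data.List.Relation.Binary.BagAndSetEquality using (∼bag⇒↭)
open import Function.Base using (_∘_; case_of_)
open import Function.Bundles using (_⇔_; mk⇔; Equivalence)
open import Relation.Nullary using (¬_; Dec; yes; no)
import Relation.Nullary.Decidable as Dec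
open import Relation.Nullary.Decidable using (_×-dec_; _⊎-dec_; _→-dec_; ¬?; dec⇒maybe)
open import Relation.Nullary.Negation using (contradiction)
open import Relation.Binary.Definitions using (tri<; tri≈; tri>)
open import Relation.Binary.Construct.Closure.ReflexiveTransitive using (Star; ε; _◅_)
open import Relation.Binary.PropositionalEquality
  using (_≡_; _≢_; refl; sym; trans; cong; cong₂; subst; subst₂; setoid; module ≡-Reasoning)
open import Tactic.RingSolver using () renaming (solve-∀ to solve-∀ᴿ)
import Tactic.RingSolver.Core.AlmostCommutativeRing as ACR

open Equivalence using (to; from)

private
  variable
    A A′ : Set

-- Duplicate-free lists

∈-remove : ∀ {x : A} {ys} → x ∈ ys →
           ∃ λ zs → length ys ≡ suc (length zs) × (∀ {y} → y ∈ ys → y ≢ x → y ∈ zs)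
∈-remove {ys = y ∷ ys} (here refl) = ys , refl , λ { (here refl) y≢x → ⊥-elim (y≢x refl) ; (there p) _ → p }
∈-remove {ys = y ∷ ys} (there p) with ∈-remove p
... | zs , eq , sub = y ∷ zs , cong suc eq , λ { (here refl) _ → here refl ; (there q) y≢x → there (sub q y≢x) }

unique⊆⇒length≤ : ∀ {xs ys : List A} → Unique xs → (∀ {x} → x ∈ xs → x ∈ ys) → length xs ≤ length ys
unique⊆⇒length≤ {xs = []} _ _ = z≤n
unique⊆⇒length≤ {xs = x ∷ xs} (x∉xs ∷ u) xs⊆ys with ∈-remove (xs⊆ys (here refl))
... | zs , eq , sub = subst (suc (length xs) ≤_) (sym eq)
  (s≤s (unique⊆⇒length≤ u (λ y∈xs → sub (xs⊆ys (there y∈xs)) λ { refl → All¬⇒¬Any x∉xs y∈xs })))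

unique-∷ʳ⁻ : ∀ {xs : List A} {v} → Unique (xs ∷ʳ v) → Unique xs × v ∉ xs
unique-∷ʳ⁻ {xs = []} _ = [] , λ ()
unique-∷ʳ⁻ {xs = x ∷ xs} (x∉ ∷ u) with ++⁻ xs x∉ | unique-∷ʳ⁻ u
... | x∉xs , (x≢v ∷ []) | u′ , v∉xs = (x∉xs ∷ u′) , λ { (here refl) → x≢v refl ; (there v∈xs) → v∉xs v∈xs }

length-∷ʳ : ∀ (xs : List A) x → length (xs ∷ʳ x) ≡ suc (length xs)
length-∷ʳ [] x = refl
length-∷ʳ (_ ∷ xs) x = cong suc (length-∷ʳ xs x)

unique-map⁺-injectiveOn : ∀ {P : A → Set} {f : A → A′} {xs} → (∀ {x y} → P x → P y → f x ≡ f y → x ≡ y) →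
                          All P xs → Unique xs → Unique (map f xs)
unique-map⁺-injectiveOn inj [] [] = []
unique-map⁺-injectiveOn inj (px ∷ pxs) (x∉ ∷ u) =
  All.map⁺ (All.zipWith (λ (x≢y , py) fx≡fy → x≢y (inj px py fx≡fy)) (x∉ , pxs)) ∷ unique-map⁺-injectiveOn inj pxs u

-- Bounded search

descent-between : ∀ (f : ℕ → ℕ) {a b} → a < b → f b < f a → ∃ λ k → a ≤ k × k < b × f (suc k) < f k
descent-between f {a} {suc b} (s≤s a≤b) fb<fa with m≤n⇒m<n∨m≡n a≤b
... | inj₂ refl = a , ≤-refl , ≤-refl , fb<fa
... | inj₁ a<b with f b <? f a
...   | yes fb<fa′ = let k , a≤k , k<b , desc = descent-between f a<b fb<fa′ in k , a≤k , m≤n⇒m≤1+n k<b , desc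
...   | no fb≮fa = b , <⇒≤ a<b , ≤-refl , <-≤-trans fb<fa (≮⇒≥ fb≮fa)

largest-below : ∀ {P : ℕ → Set} → (∀ y → Dec (P y)) → ∀ k →
                (∃ λ y → y < k × P y × ∀ {z} → y < z → z < k → ¬ P z) ⊎ (∀ {y} → y < k → ¬ P y)
largest-below P? zero = inj₂ λ ()
largest-below P? (suc k) with P? k | largest-below P? k
... | yes pk | _ = inj₁ (k , ≤-refl , pk , λ k<z z<1+k → contradiction (≤-pred z<1+k) (<⇒≱ k<z))
... | no ¬pk | inj₁ (y , y<k , py , largest) = inj₁ (y , m<n⇒m<1+n y<k , py , λ y<z z<1+k →
        case m≤n⇒m<n∨m≡n (≤-pred z<1+k) of λ where
          (inj₁ z<k) → largest y<z z<k
          (inj₂ refl) → ¬pk)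
... | no ¬pk | inj₂ none = inj₂ λ y<1+k → case m≤n⇒m<n∨m≡n (≤-pred y<1+k) of λ where
        (inj₁ y<k) → none y<k
        (inj₂ refl) → ¬pk

-- Permutations in one-line notation

InRange : ℕ → ℕ → Set
InRange n x = 1 ≤ x × x ≤ n

oneTo : ℕ → List ℕ
oneTo n = map suc (upTo n)

∈-oneTo : ∀ {n x} → x ∈ oneTo n ⇔ InRange n x
∈-oneTo = mk⇔ to′ from′
  where
  to′ : ∀ {n x} → x ∈ oneTo n → InRange n x
  to′ p with ∈-map⁻ suc p
  ... | _ , y∈ , refl = s≤s z≤n , ∈-upTo⁻ y∈
  from′ : ∀ {n x} → InRange n x → x ∈ oneTo n
  from′ (s≤s z≤n , x≤n) = ∈-map⁺ suc (∈-upTo⁺ x≤n)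

oneTo-unique : ∀ n → Unique (oneTo n)
oneTo-unique n = Unique.map⁺ suc-injective (Unique.upTo⁺ n)

length-oneTo : ∀ n → length (oneTo n) ≡ n
length-oneTo n = trans (length-map suc (upTo n)) (length-upTo n)

unique-inRange⇒length≤ : ∀ {n} {xs : List ℕ} → Unique xs → (∀ {x} → x ∈ xs → InRange n x) → length xs ≤ n
unique-inRange⇒length≤ {n} u inRange =
  subst (_ ≤_) (length-oneTo n) (unique⊆⇒length≤ u (λ x∈ → from ∈-oneTo (inRange x∈)))

Perm : ℕ → List ℕ → Set
Perm n π = Unique π × (∀ {x} → x ∈ π ⇔ InRange n x)

isPerm⇒Perm : ∀ {n π} → IsPerm n π → Perm n π
isPerm⇒Perm {n} π↭ =
  Permutationₛ.Unique-resp-↭ (setoid ℕ) (↭⇒↭ₛ (↭-sym π↭)) (oneTo-unique n) ,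
  mk⇔ (λ x∈π → to ∈-oneTo (∈-resp-↭ π↭ x∈π)) (λ x∈ → ∈-resp-↭ (↭-sym π↭) (from ∈-oneTo x∈))

Perm⇒isPerm : ∀ {n π} → Perm n π → IsPerm n π
Perm⇒isPerm {n} (u , mem) =
  ∼bag⇒↭ (unique∧set⇒bag u (oneTo-unique n) (mk⇔ (λ x∈π → from ∈-oneTo (to mem x∈π)) (λ x∈ → from mem (to ∈-oneTo x∈))))

Perm-length : ∀ {n π} → Perm n π → length π ≡ n
Perm-length {n} p = trans (↭-length (Perm⇒isPerm p)) (length-oneTo n)

unique-inRange⇒Perm : ∀ {n π} → Unique π → length π ≡ n → (∀ {x} → x ∈ π → InRange n x) → Perm n π
unique-inRange⇒Perm {n} {π} u len inRange = u , mk⇔ inRange complete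
  where
  complete : ∀ {x} → InRange n x → x ∈ π
  complete {x} x∈[1,n] with x ∈ℕ? π
  ... | yes x∈π = x∈π
  ... | no x∉π = contradiction (unique-inRange⇒length≤ {xs = x ∷ π} (All.tabulate (λ y∈π → λ { refl → x∉π y∈π }) ∷ u)
                                 λ { (here refl) → x∈[1,n] ; (there y∈π) → inRange y∈π })
                                (<-irrefl len)

∃-inRange? : ∀ {P : ℕ → Set} → (∀ j → Dec (P j)) → ∀ M → Dec (∃ λ j → InRange M j × P j)
∃-inRange? P? M = Dec.map′ (λ any → let j , j∈ , pj = find any in j , to ∈-oneTo j∈ , pj)
                           (λ (j , j∈ , pj) → lose (from ∈-oneTo j∈) pj)
                           (any? P? (oneTo M))

at-map : ∀ (f : ℕ → ℕ) xs {i} → InRange (length xs) i → at (map f xs) i ≡ f (at xs i)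
at-map f (x ∷ xs) {1} _ = refl
at-map f (x ∷ xs) {suc (suc i)} (_ , s≤s i≤) = at-map f xs (s≤s z≤n , i≤)

at-++ˡ : ∀ xs ys {i} → InRange (length xs) i → at (xs ++ ys) i ≡ at xs i
at-++ˡ (x ∷ xs) ys {1} _ = refl
at-++ˡ (x ∷ xs) ys {suc (suc i)} (_ , s≤s i≤) = at-++ˡ xs ys (s≤s z≤n , i≤)

at-∷ʳ : ∀ xs (v : ℕ) → at (xs ∷ʳ v) (suc (length xs)) ≡ v
at-∷ʳ [] v = refl
at-∷ʳ (x ∷ []) v = refl
at-∷ʳ (x ∷ y ∷ xs) v = at-∷ʳ (y ∷ xs) v

at-∈ : ∀ xs {i} → InRange (length xs) i → at xs i ∈ xs
at-∈ (x ∷ xs) {1} _ = here refl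
at-∈ (x ∷ xs) {suc (suc i)} (_ , s≤s i≤) = there (at-∈ xs (s≤s z≤n , i≤))

∈⇒at : ∀ {x} xs → x ∈ xs → ∃ λ i → InRange (length xs) i × at xs i ≡ x
∈⇒at (y ∷ xs) (here refl) = 1 , (s≤s z≤n , s≤s z≤n) , refl
∈⇒at (y ∷ xs) (there x∈xs) with ∈⇒at xs x∈xs
... | suc i , (_ , i≤) , eq = suc (suc i) , (s≤s z≤n , s≤s i≤) , eq

at-injective : ∀ xs {i j} → Unique xs → InRange (length xs) i → InRange (length xs) j → at xs i ≡ at xs j → i ≡ j
at-injective (x ∷ xs) {1} {1} _ _ _ _ = refl
at-injective (x ∷ xs) {1} {suc (suc j)} (x∉xs ∷ _) _ (_ , s≤s j≤) eq =
  ⊥-elim (All¬⇒¬Any x∉xs (subst (_∈ xs) (sym eq) (at-∈ xs (s≤s z≤n , j≤))))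
at-injective (x ∷ xs) {suc (suc i)} {1} (x∉xs ∷ _) (_ , s≤s i≤) _ eq =
  ⊥-elim (All¬⇒¬Any x∉xs (subst (_∈ xs) eq (at-∈ xs (s≤s z≤n , i≤))))
at-injective (x ∷ xs) {suc (suc i)} {suc (suc j)} (_ ∷ u) (_ , s≤s i≤) (_ , s≤s j≤) eq =
  cong suc (at-injective xs u (s≤s z≤n , i≤) (s≤s z≤n , j≤) eq)

module _ {n π} (p : Perm n π) where

  inRange-length : ∀ {i} → InRange n i → InRange (length π) i
  inRange-length (1≤i , i≤n) = 1≤i , subst (_ ≤_) (sym (Perm-length p)) i≤n

  Perm-at : ∀ {i} → InRange n i → InRange n (at π i)
  Perm-at i∈ = to (proj₂ p) (at-∈ π (inRange-length i∈))

  Perm-at-injective : ∀ {i j} → InRange n i → InRange n j → at π i ≡ at π j → i ≡ j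
  Perm-at-injective i∈ j∈ = at-injective π (proj₁ p) (inRange-length i∈) (inRange-length j∈)

-- bump v makes room for a new value v: values ≥ v move up by one.
bump : ℕ → ℕ → ℕ
bump v x with x <? v
... | yes _ = x
... | no _ = suc x

bump-< : ∀ {v x} → x < v → bump v x ≡ x
bump-< {v} {x} x<v with x <? v
... | yes _ = refl
... | no x≮v = contradiction x<v x≮v

bump-≥ : ∀ {v x} → v ≤ x → bump v x ≡ suc x
bump-≥ {v} {x} v≤x with x <? v
... | yes x<v = contradiction v≤x (<⇒≱ x<v)
... | no _ = refl

bump-cases : ∀ v x → (x < v × bump v x ≡ x) ⊎ (v ≤ x × bump v x ≡ suc x)
bump-cases v x with x <? v
... | yes x<v = inj₁ (x<v , refl)
... | no x≮v = inj₂ (≮⇒≥ x≮v , refl)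

bump≢ : ∀ v x → bump v x ≢ v
bump≢ v x with bump-cases v x
... | inj₁ (x<v , eq) = λ e → <⇒≢ x<v (trans (sym eq) e)
... | inj₂ (v≤x , eq) = λ e → <⇒≢ (s≤s v≤x) (sym (trans (sym eq) e))

bump-mono-< : ∀ v {x y} → x < y → bump v x < bump v y
bump-mono-< v {x} {y} x<y with bump-cases v x | bump-cases v y
... | inj₁ (_ , ex) | inj₁ (_ , ey) = subst₂ _<_ (sym ex) (sym ey) x<y
... | inj₁ (_ , ex) | inj₂ (_ , ey) = subst₂ _<_ (sym ex) (sym ey) (m<n⇒m<1+n x<y)
... | inj₂ (v≤x , _) | inj₁ (y<v , _) = contradiction (<-trans x<y y<v) (≤⇒≯ v≤x)
... | inj₂ (_ , ex) | inj₂ (_ , ey) = subst₂ _<_ (sym ex) (sym ey) (s≤s x<y)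

bump-cancel-< : ∀ v {x y} → bump v x < bump v y → x < y
bump-cancel-< v {x} {y} lt with <-cmp x y
... | tri< x<y _ _ = x<y
... | tri≈ _ refl _ = contradiction lt (<-irrefl refl)
... | tri> _ _ y<x = contradiction lt (<-asym (bump-mono-< v y<x))

bump-injective : ∀ v {x y} → bump v x ≡ bump v y → x ≡ y
bump-injective v {x} {y} eq with <-cmp x y
... | tri< x<y _ _ = contradiction eq (<⇒≢ (bump-mono-< v x<y))
... | tri≈ _ x≡y _ = x≡y
... | tri> _ _ y<x = contradiction (sym eq) (<⇒≢ (bump-mono-< v y<x))

bump-inRange : ∀ {n} v {x} → InRange n x → InRange (suc n) (bump v x)
bump-inRange v {x} (1≤x , x≤n) with bump-cases v x
... | inj₁ (_ , eq) = subst (InRange _) (sym eq) (1≤x , m≤n⇒m≤1+n x≤n)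
... | inj₂ (_ , eq) = subst (InRange _) (sym eq) (s≤s z≤n , s≤s x≤n)

bump-inRange⁻ : ∀ {n v x} → InRange (suc n) v → InRange (suc n) (bump v x) → InRange n x
bump-inRange⁻ {n} {v} {x} (1≤v , v≤1+n) (1≤b , b≤1+n) with bump-cases v x
... | inj₁ (x<v , eq) = subst (1 ≤_) eq 1≤b , ≤-pred (≤-trans x<v v≤1+n)
... | inj₂ (v≤x , eq) = ≤-trans 1≤v v≤x , ≤-pred (subst (_≤ suc n) eq b≤1+n)

unbump : ℕ → ℕ → ℕ
unbump v x with x <? v
... | yes _ = x
... | no _ = pred x

unbump-< : ∀ {v x} → x < v → unbump v x ≡ x
unbump-< {v} {x} x<v with x <? v
... | yes _ = refl
... | no x≮v = contradiction x<v x≮v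

unbump-> : ∀ {v x} → v < x → unbump v x ≡ pred x
unbump-> {v} {x} v<x with x <? v
... | yes x<v = contradiction x<v (<-asym v<x)
... | no _ = refl

bump-unbump : ∀ v {x} → x ≢ v → bump v (unbump v x) ≡ x
bump-unbump v {x} x≢v with x <? v
... | yes x<v = bump-< x<v
bump-unbump v {zero} x≢v | no x≮v = contradiction (≤-antisym (≮⇒≥ x≮v) z≤n) (x≢v ∘ sym)
bump-unbump v {suc x} x≢v | no x≮v = bump-≥ (≤-pred (≤∧≢⇒< (≮⇒≥ x≮v) (x≢v ∘ sym)))

unbump-injective : ∀ y {z z′} → z ≢ y → z′ ≢ y → unbump y z ≡ unbump y z′ → z ≡ z′
unbump-injective y {z} {z′} z≢y z′≢y eq = trans (sym (bump-unbump y z≢y)) (trans (cong (bump y) eq) (bump-unbump y z′≢y))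

unbump-mono-< : ∀ y {z z′} → z ≢ y → z′ ≢ y → z < z′ → unbump y z < unbump y z′
unbump-mono-< y z≢y z′≢y z<z′ = bump-cancel-< y (subst₂ _<_ (sym (bump-unbump y z≢y)) (sym (bump-unbump y z′≢y)) z<z′)

v<bump⇔v≤ : ∀ {v x} → v < bump v x ⇔ v ≤ x
v<bump⇔v≤ {v} {x} with bump-cases v x
... | inj₁ (x<v , eq) = mk⇔ (λ v<b → contradiction (subst (v <_) eq v<b) (<-asym x<v)) (λ v≤x → contradiction x<v (≤⇒≯ v≤x))
... | inj₂ (v≤x , eq) = mk⇔ (λ _ → v≤x) (λ _ → subst (v <_) (sym eq) (s≤s v≤x))

-- The permutation of [n + 1] ending in v whose first n entries are in the same relative order as π.
extend : List ℕ → ℕ → List ℕ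
extend π v = map (bump v) π ∷ʳ v

extend-injective : ∀ {π π′ v v′} → extend π v ≡ extend π′ v′ → π ≡ π′ × v ≡ v′
extend-injective {π} {π′} {v} eq with ∷ʳ-injective (map (bump v) π) _ eq
... | eqπ , refl = map-injective (bump-injective v) eqπ , refl

at-extend : ∀ π v {i} → InRange (length π) i → at (extend π v) i ≡ bump v (at π i)
at-extend π v (1≤i , i≤) =
  trans (at-++ˡ (map (bump v) π) _ (1≤i , subst (_ ≤_) (sym (length-map (bump v) π)) i≤)) (at-map (bump v) π (1≤i , i≤))

at-extend-last : ∀ {n} π v → length π ≡ n → at (extend π v) (suc n) ≡ v
at-extend-last π v refl = subst (λ k → at (extend π v) (suc k) ≡ v) (length-map (bump v) π) (at-∷ʳ (map (bump v) π) v)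

Perm-extend : ∀ {n π v} → Perm n π → InRange (suc n) v → Perm (suc n) (extend π v)
Perm-extend {n} {π} {v} p v∈ = unique-inRange⇒Perm unique len inRange
  where
  unique : Unique (extend π v)
  unique = Unique.++⁺ (Unique.map⁺ (bump-injective v) (proj₁ p)) ([] ∷ [])
    λ { (b∈ , here refl) → let (x , _ , eq) = ∈-map⁻ (bump v) b∈ in bump≢ v x (sym eq) }
  len : length (extend π v) ≡ suc n
  len = trans (length-∷ʳ (map (bump v) π) v) (cong suc (trans (length-map (bump v) π) (Perm-length p)))
  inRange : ∀ {y} → y ∈ extend π v → InRange (suc n) y
  inRange y∈ with ∈-++⁻ (map (bump v) π) y∈
  ... | inj₂ (here refl) = v∈
  ... | inj₁ b∈ with ∈-map⁻ (bump v) b∈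
  ...   | x , x∈π , refl = bump-inRange v (to (proj₂ p) x∈π)

Perm-unextend : ∀ {n σ} → Perm (suc n) σ → ∃ λ π → ∃ λ v → σ ≡ extend π v × Perm n π × InRange (suc n) v
Perm-unextend {n} {σ} p with initLast σ
... | [] = contradiction (Perm-length p) λ ()
... | ys ∷ʳ′ v = π , v , cong (_∷ʳ v) (sym bump∘unbump) , unique-inRange⇒Perm unique len inRange , v∈
  where
  ys-unique = proj₁ (unique-∷ʳ⁻ (proj₁ p))
  v∉ys = proj₂ (unique-∷ʳ⁻ (proj₁ p))
  π = map (unbump v) ys
  v∈ : InRange (suc n) v
  v∈ = to (proj₂ p) (∈-++⁺ʳ ys (here refl))
  bump∘unbump : map (bump v) π ≡ ys
  bump∘unbump = trans (sym (map-∘ ys))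
    (map-id-local (All.tabulate λ y∈ys → bump-unbump v λ { refl → v∉ys y∈ys }))
  unique : Unique π
  unique = Unique.map⁻ (subst Unique (sym bump∘unbump) ys-unique)
  len : length π ≡ n
  len = suc-injective (trans (cong suc (length-map (unbump v) ys)) (trans (sym (length-∷ʳ ys v)) (Perm-length p)))
  inRange : ∀ {x} → x ∈ π → InRange n x
  inRange x∈π = bump-inRange⁻ v∈ (to (proj₂ p) (∈-++⁺ˡ (subst (_ ∈_) bump∘unbump (∈-map⁺ (bump v) x∈π))))

extensions : (List ℕ → List ℕ) → List (List ℕ) → List (List ℕ)
extensions V [] = []
extensions V (π ∷ πs) = map (extend π) (V π) ++ extensions V πs

∈-extensions⁻ : ∀ V πs {σ} → σ ∈ extensions V πs → ∃ λ π → ∃ λ v → π ∈ πs × v ∈ V π × σ ≡ extend π v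
∈-extensions⁻ V (π ∷ πs) σ∈ with ∈-++⁻ (map (extend π) (V π)) σ∈
... | inj₁ σ∈π with ∈-map⁻ (extend π) σ∈π
...   | v , v∈ , eq = π , v , here refl , v∈ , eq
∈-extensions⁻ V (π ∷ πs) σ∈ | inj₂ σ∈πs with ∈-extensions⁻ V πs σ∈πs
... | π′ , v , π′∈ , v∈ , eq = π′ , v , there π′∈ , v∈ , eq

∈-extensions⁺ : ∀ V πs {π v} → π ∈ πs → v ∈ V π → extend π v ∈ extensions V πs
∈-extensions⁺ V (π ∷ πs) (here refl) v∈ = ∈-++⁺ˡ (∈-map⁺ (extend π) v∈)
∈-extensions⁺ V (π ∷ πs) (there π∈) v∈ = ∈-++⁺ʳ (map (extend π) (V π)) (∈-extensions⁺ V πs π∈ v∈)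

extensions-unique : ∀ V πs → Unique πs → (∀ π → Unique (V π)) → Unique (extensions V πs)
extensions-unique V [] _ _ = []
extensions-unique V (π ∷ πs) (π∉ ∷ u) uV =
  Unique.++⁺ (Unique.map⁺ (proj₂ ∘ extend-injective) (uV π)) (extensions-unique V πs u uV) disjoint
  where
  disjoint : ∀ {σ} → σ ∈ map (extend π) (V π) × σ ∈ extensions V πs → _
  disjoint (σ∈ , σ∈′) with ∈-map⁻ (extend π) σ∈ | ∈-extensions⁻ V πs σ∈′
  ... | _ , _ , refl | π′ , _ , π′∈ , _ , eq = All¬⇒¬Any π∉ (subst (_∈ πs) (sym (proj₁ (extend-injective eq))) π′∈)

sum-extensions : ∀ (f : List ℕ → ℕ) V πs →
                 sum (map f (extensions V πs)) ≡ sum (map (λ π → sum (map (f ∘ extend π) (V π))) πs)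
sum-extensions f V [] = refl
sum-extensions f V (π ∷ πs) = begin
  sum (map f (map (extend π) (V π) ++ extensions V πs))
    ≡⟨ cong sum (map-++ f (map (extend π) (V π)) _) ⟩
  sum (map f (map (extend π) (V π)) ++ map f (extensions V πs))
    ≡⟨ sum-++ (map f (map (extend π) (V π))) _ ⟩
  sum (map f (map (extend π) (V π))) + sum (map f (extensions V πs))
    ≡⟨ cong₂ _+_ (cong sum (sym (map-∘ (V π)))) (sum-extensions f V πs) ⟩
  sum (map (f ∘ extend π) (V π)) + sum (map (λ π → sum (map (f ∘ extend π) (V π))) πs) ∎
  where open ≡-Reasoning

perms : ℕ → List (List ℕ)
perms zero = [ [] ]
perms (suc n) = extensions (λ _ → oneTo (suc n)) (perms n)

∈-perms : ∀ {n σ} → σ ∈ perms n ⇔ Perm n σ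
∈-perms {zero} = mk⇔ (λ { (here refl) → [] , mk⇔ (λ ()) λ (1≤x , x≤0) → contradiction (≤-trans 1≤x x≤0) λ () })
                     (λ p → here (length0 (Perm-length p)))
  where
  length0 : ∀ {σ : List ℕ} → length σ ≡ 0 → σ ≡ []
  length0 {[]} _ = refl
∈-perms {suc n} = mk⇔ to′ from′
  where
  to′ : ∀ {σ} → σ ∈ perms (suc n) → Perm (suc n) σ
  to′ σ∈ with ∈-extensions⁻ _ (perms n) σ∈
  ... | π , v , π∈ , v∈ , refl = Perm-extend (to ∈-perms π∈) (to ∈-oneTo v∈)
  from′ : ∀ {σ} → Perm (suc n) σ → σ ∈ perms (suc n)
  from′ p with Perm-unextend p
  ... | π , v , refl , pπ , v∈ = ∈-extensions⁺ _ (perms n) (from ∈-perms pπ) (from ∈-oneTo v∈)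

perms-unique : ∀ n → Unique (perms n)
perms-unique zero = [] ∷ []
perms-unique (suc n) = extensions-unique _ (perms n) (perms-unique n) (λ _ → oneTo-unique (suc n))

-- Binomial coefficients

[k+1]*[n+1]C[k+1]≡[n+1]*nCk : ∀ n k → suc k * (suc n C suc k) ≡ suc n * (n C k)
[k+1]*[n+1]C[k+1]≡[n+1]*nCk zero zero = cong (1 *_) (trans (nCn≡1 1) (sym (nCn≡1 0)))
[k+1]*[n+1]C[k+1]≡[n+1]*nCk zero (suc k) = begin
  suc (suc k) * (1 C suc (suc k)) ≡⟨ cong (suc (suc k) *_) (k>n⇒nCk≡0 (s≤s (s≤s (z≤n {k})))) ⟩
  suc (suc k) * 0                 ≡⟨ *-zeroʳ (suc (suc k)) ⟩
  0                               ≡⟨ k>n⇒nCk≡0 (s≤s (z≤n {k})) ⟨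
  0 C suc k                       ≡⟨ *-identityˡ _ ⟨
  1 * (0 C suc k)                 ∎
  where open ≡-Reasoning
[k+1]*[n+1]C[k+1]≡[n+1]*nCk (suc n) zero =
  trans (*-identityˡ _) (trans (nC1≡n (suc (suc n))) (sym (*-identityʳ (suc (suc n)))))
[k+1]*[n+1]C[k+1]≡[n+1]*nCk (suc n) (suc k) = begin
  suc (suc k) * (suc (suc n) C suc (suc k))
    ≡⟨ cong (suc (suc k) *_) (sym (nCk+nC[k+1]≡[n+1]C[k+1] (suc n) (suc k))) ⟩
  suc (suc k) * (a + b)
    ≡⟨ rearrange a b k ⟩
  a + (suc k * a + suc (suc k) * b)
    ≡⟨ cong (a +_) (cong₂ _+_ ([k+1]*[n+1]C[k+1]≡[n+1]*nCk n k) ([k+1]*[n+1]C[k+1]≡[n+1]*nCk n (suc k))) ⟩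
  a + (suc n * (n C k) + suc n * (n C suc k))
    ≡⟨ cong (a +_) (trans (sym (*-distribˡ-+ (suc n) (n C k) _)) (cong (suc n *_) (nCk+nC[k+1]≡[n+1]C[k+1] n k))) ⟩
  suc (suc n) * a ∎
  where
  open ≡-Reasoning
  a = suc n C suc k
  b = suc n C suc (suc k)
  rearrange : ∀ a b k → suc (suc k) * (a + b) ≡ a + (suc k * a + suc (suc k) * b)
  rearrange = solve-∀ℕ

binom : ℕ → ℕ → ℕ
binom e t = (t + e) C e

binom-zero : ∀ e → binom e 0 ≡ 1
binom-zero = nCn≡1

binom-pascal : ∀ e t → binom (suc e) t + binom e (suc t) ≡ binom (suc e) (suc t)
binom-pascal e t = begin
  (t + suc e) C suc e + suc (t + e) C e ≡⟨ cong₂ _+_ (cong (_C suc e) (+-suc t e)) refl ⟩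
  suc (t + e) C suc e + suc (t + e) C e ≡⟨ +-comm (suc (t + e) C suc e) _ ⟩
  suc (t + e) C e + suc (t + e) C suc e ≡⟨ nCk+nC[k+1]≡[n+1]C[k+1] (suc (t + e)) e ⟩
  suc (suc (t + e)) C suc e            ≡⟨ cong (λ m → suc m C suc e) (+-suc t e) ⟨
  suc (t + suc e) C suc e              ∎
  where open ≡-Reasoning

hockey-stick : ∀ e t → sum (map (λ w → binom (e ∸ w) t) (upTo (suc e))) ≡ binom e (suc t)
hockey-stick zero t = refl
hockey-stick (suc e) t = begin
  binom (suc e) t + sum (map f (applyUpTo suc (suc e)))
    ≡⟨ cong (λ ws → binom (suc e) t + sum (map f ws)) (sym (map-upTo suc (suc e))) ⟩
  binom (suc e) t + sum (map f (map suc (upTo (suc e))))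
    ≡⟨ cong (λ xs → binom (suc e) t + sum xs) (sym (map-∘ (upTo (suc e)))) ⟩
  binom (suc e) t + sum (map (λ w → binom (e ∸ w) t) (upTo (suc e)))
    ≡⟨ cong (binom (suc e) t +_) (hockey-stick e t) ⟩
  binom (suc e) t + binom e (suc t)
    ≡⟨ binom-pascal e t ⟩
  binom (suc e) (suc t) ∎
  where
  open ≡-Reasoning
  f = λ w → binom (suc e ∸ w) t

binom-absorb : ∀ e t → suc e * binom (suc e) t ≡ (suc e + t) * binom e t
binom-absorb e t = begin
  suc e * ((t + suc e) C suc e) ≡⟨ cong (λ m → suc e * (m C suc e)) (+-suc t e) ⟩
  suc e * (suc (t + e) C suc e) ≡⟨ [k+1]*[n+1]C[k+1]≡[n+1]*nCk (t + e) e ⟩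
  suc (t + e) * binom e t       ≡⟨ cong (λ m → suc m * binom e t) (+-comm t e) ⟩
  (suc e + t) * binom e t       ∎
  where open ≡-Reasoning

-- Polynomials over ℚ

ℚ-ring : ACR.AlmostCommutativeRing 0ℓ 0ℓ
ℚ-ring = ACR.fromCommutativeRing ℚ.+-*-commutativeRing (λ x → dec⇒maybe (0ℚ ℚ.≟ x))

ℕtoℚ≡mkℚ : ∀ n → ℕtoℚ n ≡ mkℚ (ℤ.+ n) 0 (Coprime.sym (1-coprimeTo n))
ℕtoℚ≡mkℚ n = ℚ.normalize-coprime (Coprime.sym (1-coprimeTo n))

toℚᵘ-ℕtoℚ : ∀ n → toℚᵘ (ℕtoℚ n) ≡ ℚᵘ.mkℚᵘ (ℤ.+ n) 0
toℚᵘ-ℕtoℚ n = cong toℚᵘ (ℕtoℚ≡mkℚ n)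

ℕtoℚ-+ : ∀ a b → ℕtoℚ (a + b) ≡ ℕtoℚ a +ℚ ℕtoℚ b
ℕtoℚ-+ a b = ℚ.toℚᵘ-injective (begin
  toℚᵘ (ℕtoℚ (a + b))                      ≡⟨ toℚᵘ-ℕtoℚ (a + b) ⟩
  ℚᵘ.mkℚᵘ (ℤ.+ (a + b)) 0                  ≈⟨ ℚᵘ.*≡* (cong (ℤ._* ℤ.+ 1) (trans (ℤ.pos-+ a b) (sym numerators))) ⟩
  ℚᵘ.mkℚᵘ (ℤ.+ a) 0 ℚᵘ.+ ℚᵘ.mkℚᵘ (ℤ.+ b) 0 ≡⟨ cong₂ ℚᵘ._+_ (toℚᵘ-ℕtoℚ a) (toℚᵘ-ℕtoℚ b) ⟨
  toℚᵘ (ℕtoℚ a) ℚᵘ.+ toℚᵘ (ℕtoℚ b)         ≈⟨ ℚ.toℚᵘ-homo-+ (ℕtoℚ a) (ℕtoℚ b) ⟨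
  toℚᵘ (ℕtoℚ a +ℚ ℕtoℚ b)                  ∎)
  where
  open ℚᵘ.≃-Reasoning
  numerators = cong₂ ℤ._+_ (ℤ.*-identityʳ (ℤ.+ a)) (ℤ.*-identityʳ (ℤ.+ b))

ℕtoℚ-* : ∀ a b → ℕtoℚ (a * b) ≡ ℕtoℚ a *ℚ ℕtoℚ b
ℕtoℚ-* a b = ℚ.toℚᵘ-injective (begin
  toℚᵘ (ℕtoℚ (a * b))                      ≡⟨ toℚᵘ-ℕtoℚ (a * b) ⟩
  ℚᵘ.mkℚᵘ (ℤ.+ (a * b)) 0                  ≈⟨ ℚᵘ.*≡* (cong (ℤ._* ℤ.+ 1) (ℤ.pos-* a b)) ⟩
  ℚᵘ.mkℚᵘ (ℤ.+ a) 0 ℚᵘ.* ℚᵘ.mkℚᵘ (ℤ.+ b) 0 ≡⟨ cong₂ ℚᵘ._*_ (toℚᵘ-ℕtoℚ a) (toℚᵘ-ℕtoℚ b) ⟨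
  toℚᵘ (ℕtoℚ a) ℚᵘ.* toℚᵘ (ℕtoℚ b)         ≈⟨ ℚ.toℚᵘ-homo-* (ℕtoℚ a) (ℕtoℚ b) ⟨
  toℚᵘ (ℕtoℚ a *ℚ ℕtoℚ b)                  ∎)
  where open ℚᵘ.≃-Reasoning

ℕtoℚ-suc-positive : ∀ n → Positive (ℕtoℚ (suc n))
ℕtoℚ-suc-positive n = subst Positive (sym (ℕtoℚ≡mkℚ (suc n))) _

1/[1+_] : ℕ → ℚ
1/[1+ n ] = (1/ ℕtoℚ (suc n)) {{ℚ.pos⇒nonZero (ℕtoℚ (suc n)) {{ℕtoℚ-suc-positive n}}}}

1/[1+n]-positive : ∀ n → Positive 1/[1+ n ]
1/[1+n]-positive n = ℚ.1/pos⇒pos (ℕtoℚ (suc n)) {{ℕtoℚ-suc-positive n}}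

[1+n]*1/[1+n]≡1 : ∀ n → ℕtoℚ (suc n) *ℚ 1/[1+ n ] ≡ 1ℚ
[1+n]*1/[1+n]≡1 n = ℚ.*-inverseʳ (ℕtoℚ (suc n)) {{ℚ.pos⇒nonZero (ℕtoℚ (suc n)) {{ℕtoℚ-suc-positive n}}}}

-- Coefficient lists, constant term first.
Poly : Set
Poly = List ℚ

eval : Poly → ℚ → ℚ
eval [] x = 0ℚ
eval (a ∷ p) x = a +ℚ x *ℚ eval p x

coeff : Poly → ℕ → ℚ
coeff [] k = 0ℚ
coeff (a ∷ p) zero = a
coeff (a ∷ p) (suc k) = coeff p k

infixl 6 _⊕_
_⊕_ : Poly → Poly → Poly
[] ⊕ q = q
(a ∷ p) ⊕ [] = a ∷ p
(a ∷ p) ⊕ (b ∷ q) = (a +ℚ b) ∷ (p ⊕ q)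

scale : ℚ → Poly → Poly
scale c = map (c *ℚ_)

mulLinear : Poly → ℚ → ℚ → Poly
mulLinear p a b = scale a p ⊕ (0ℚ ∷ scale b p)

eval-⊕ : ∀ p q x → eval (p ⊕ q) x ≡ eval p x +ℚ eval q x
eval-⊕ [] q x = sym (ℚ.+-identityˡ _)
eval-⊕ (a ∷ p) [] x = sym (ℚ.+-identityʳ _)
eval-⊕ (a ∷ p) (b ∷ q) x = trans (cong (λ r → (a +ℚ b) +ℚ x *ℚ r) (eval-⊕ p q x)) (rearrange a b x (eval p x) (eval q x))
  where
  rearrange : ∀ a b x P Q → (a +ℚ b) +ℚ x *ℚ (P +ℚ Q) ≡ (a +ℚ x *ℚ P) +ℚ (b +ℚ x *ℚ Q)
  rearrange = solve-∀ᴿ ℚ-ring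

eval-scale : ∀ c p x → eval (scale c p) x ≡ c *ℚ eval p x
eval-scale c [] x = sym (ℚ.*-zeroʳ c)
eval-scale c (a ∷ p) x = trans (cong (λ r → c *ℚ a +ℚ x *ℚ r) (eval-scale c p x)) (rearrange c a x (eval p x))
  where
  rearrange : ∀ c a x P → c *ℚ a +ℚ x *ℚ (c *ℚ P) ≡ c *ℚ (a +ℚ x *ℚ P)
  rearrange = solve-∀ᴿ ℚ-ring

eval-mulLinear : ∀ p a b x → eval (mulLinear p a b) x ≡ eval p x *ℚ (a +ℚ b *ℚ x)
eval-mulLinear p a b x = begin
  eval (scale a p ⊕ (0ℚ ∷ scale b p)) x
    ≡⟨ eval-⊕ (scale a p) (0ℚ ∷ scale b p) x ⟩
  eval (scale a p) x +ℚ (0ℚ +ℚ x *ℚ eval (scale b p) x)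
    ≡⟨ cong₂ (λ u v → u +ℚ (0ℚ +ℚ x *ℚ v)) (eval-scale a p x) (eval-scale b p x) ⟩
  a *ℚ eval p x +ℚ (0ℚ +ℚ x *ℚ (b *ℚ eval p x))
    ≡⟨ rearrange a b x (eval p x) ⟩
  eval p x *ℚ (a +ℚ b *ℚ x) ∎
  where
  open ≡-Reasoning
  rearrange : ∀ a b x P → a *ℚ P +ℚ (0ℚ +ℚ x *ℚ (b *ℚ P)) ≡ P *ℚ (a +ℚ b *ℚ x)
  rearrange = solve-∀ᴿ ℚ-ring

coeff-⊕ : ∀ p q k → coeff (p ⊕ q) k ≡ coeff p k +ℚ coeff q k
coeff-⊕ [] q k = sym (ℚ.+-identityˡ _)
coeff-⊕ (a ∷ p) [] zero = sym (ℚ.+-identityʳ _)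
coeff-⊕ (a ∷ p) [] (suc k) = sym (ℚ.+-identityʳ _)
coeff-⊕ (a ∷ p) (b ∷ q) zero = refl
coeff-⊕ (a ∷ p) (b ∷ q) (suc k) = coeff-⊕ p q k

coeff-scale : ∀ c p k → coeff (scale c p) k ≡ c *ℚ coeff p k
coeff-scale c [] k = sym (ℚ.*-zeroʳ c)
coeff-scale c (a ∷ p) zero = refl
coeff-scale c (a ∷ p) (suc k) = coeff-scale c p k

coeff-mulLinear : ∀ p a b k → coeff (mulLinear p a b) (suc k) ≡ a *ℚ coeff p (suc k) +ℚ b *ℚ coeff p k
coeff-mulLinear p a b k =
  trans (coeff-⊕ (scale a p) (0ℚ ∷ scale b p) (suc k)) (cong₂ _+ℚ_ (coeff-scale a p (suc k)) (coeff-scale b p k))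

coeff-length : ∀ p {k} → length p ≤ k → coeff p k ≡ 0ℚ
coeff-length [] _ = refl
coeff-length (a ∷ p) (s≤s len≤k) = coeff-length p len≤k

length-⊕ : ∀ p q {K} → length p ≤ K → length q ≤ K → length (p ⊕ q) ≤ K
length-⊕ [] q _ q≤ = q≤
length-⊕ (a ∷ p) [] p≤ _ = p≤
length-⊕ (a ∷ p) (b ∷ q) (s≤s p≤) (s≤s q≤) = s≤s (length-⊕ p q p≤ q≤)

length-mulLinear : ∀ p a b {K} → length p ≤ K → length (mulLinear p a b) ≤ suc K
length-mulLinear p a b p≤ = length-⊕ (scale a p) (0ℚ ∷ scale b p)
  (m≤n⇒m≤1+n (subst (_≤ _) (sym (length-map (a *ℚ_) p)) p≤))
  (s≤s (subst (_≤ _) (sym (length-map (b *ℚ_) p)) p≤))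

-- binomialPoly J e = ∏_{i<e} (X − J + i + 1)/(i + 1), whose value at J + t is binom e t.
binomialPoly : ℕ → ℕ → Poly
binomialPoly J zero = 1ℚ ∷ []
binomialPoly J (suc e) = mulLinear (binomialPoly J e) ((ℕtoℚ (suc e) -ℚ ℕtoℚ J) *ℚ 1/[1+ e ]) 1/[1+ e ]

length-binomialPoly : ∀ J e → length (binomialPoly J e) ≤ suc e
length-binomialPoly J zero = s≤s z≤n
length-binomialPoly J (suc e) =
  length-mulLinear (binomialPoly J e) ((ℕtoℚ (suc e) -ℚ ℕtoℚ J) *ℚ 1/[1+ e ]) 1/[1+ e ] (length-binomialPoly J e)

leading-binomialPoly : ∀ J e → 0ℚ <ℚ coeff (binomialPoly J e) e
leading-binomialPoly J zero = ℚ.positive⁻¹ 1ℚ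
leading-binomialPoly J (suc e) = subst (0ℚ <ℚ_) (sym leading) (ℚ.positive⁻¹ _ {{ℚ.pos*pos⇒pos inv _}})
  where
  inv = 1/[1+ e ]
  a = (ℕtoℚ (suc e) -ℚ ℕtoℚ J) *ℚ inv
  P = binomialPoly J e
  length≤ = length-binomialPoly J e
  instance
    _ : Positive inv
    _ = 1/[1+n]-positive e
    _ : Positive (coeff P e)
    _ = positive (leading-binomialPoly J e)
  leading : coeff (binomialPoly J (suc e)) (suc e) ≡ inv *ℚ coeff P e
  leading = begin
    coeff (binomialPoly J (suc e)) (suc e)     ≡⟨ coeff-mulLinear P a inv e ⟩
    a *ℚ coeff P (suc e) +ℚ inv *ℚ coeff P e   ≡⟨ cong (λ c → a *ℚ c +ℚ inv *ℚ coeff P e) (coeff-length P length≤) ⟩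
    a *ℚ 0ℚ +ℚ inv *ℚ coeff P e                ≡⟨ cong (_+ℚ inv *ℚ coeff P e) (ℚ.*-zeroʳ a) ⟩
    0ℚ +ℚ inv *ℚ coeff P e                     ≡⟨ ℚ.+-identityˡ _ ⟩
    inv *ℚ coeff P e                           ∎
    where open ≡-Reasoning

eval-binomialPoly : ∀ J e t → eval (binomialPoly J e) (ℕtoℚ (J + t)) ≡ ℕtoℚ (binom e t)
eval-binomialPoly J zero t = trans (cong (1ℚ +ℚ_) (ℚ.*-zeroʳ (ℕtoℚ (J + t)))) (ℚ.+-identityʳ 1ℚ)
eval-binomialPoly J (suc e) t = begin
  eval (binomialPoly J (suc e)) (ℕtoℚ (J + t))
    ≡⟨ eval-mulLinear (binomialPoly J e) ((s -ℚ j) *ℚ inv) inv _ ⟩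
  eval (binomialPoly J e) (ℕtoℚ (J + t)) *ℚ ((s -ℚ j) *ℚ inv +ℚ inv *ℚ ℕtoℚ (J + t))
    ≡⟨ cong₂ (λ u x → u *ℚ ((s -ℚ j) *ℚ inv +ℚ inv *ℚ x)) (eval-binomialPoly J e t) (ℕtoℚ-+ J t) ⟩
  B *ℚ ((s -ℚ j) *ℚ inv +ℚ inv *ℚ (j +ℚ ℕtoℚ t))
    ≡⟨ rearrange B s j (ℕtoℚ t) inv ⟩
  ((s +ℚ ℕtoℚ t) *ℚ B) *ℚ inv
    ≡⟨ cong (_*ℚ inv) (trans (ℕtoℚ-* (suc e + t) (binom e t)) (cong (_*ℚ B) (ℕtoℚ-+ (suc e) t))) ⟨
  ℕtoℚ ((suc e + t) * binom e t) *ℚ inv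
    ≡⟨ cong (λ n → ℕtoℚ n *ℚ inv) (binom-absorb e t) ⟨
  ℕtoℚ (suc e * binom (suc e) t) *ℚ inv
    ≡⟨ cong (_*ℚ inv) (ℕtoℚ-* (suc e) (binom (suc e) t)) ⟩
  (s *ℚ ℕtoℚ (binom (suc e) t)) *ℚ inv
    ≡⟨ cong (_*ℚ inv) (ℚ.*-comm s (ℕtoℚ (binom (suc e) t))) ⟩
  (ℕtoℚ (binom (suc e) t) *ℚ s) *ℚ inv
    ≡⟨ ℚ.*-assoc (ℕtoℚ (binom (suc e) t)) s inv ⟩
  ℕtoℚ (binom (suc e) t) *ℚ (s *ℚ inv)
    ≡⟨ cong (ℕtoℚ (binom (suc e) t) *ℚ_) ([1+n]*1/[1+n]≡1 e) ⟩
  ℕtoℚ (binom (suc e) t) *ℚ 1ℚ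
    ≡⟨ ℚ.*-identityʳ (ℕtoℚ (binom (suc e) t)) ⟩
  ℕtoℚ (binom (suc e) t) ∎
  where
  open ≡-Reasoning
  s = ℕtoℚ (suc e)
  j = ℕtoℚ J
  inv = 1/[1+ e ]
  B = ℕtoℚ (binom e t)
  rearrange : ∀ B s j u i → B *ℚ ((s -ℚ j) *ℚ i +ℚ i *ℚ (j +ℚ u)) ≡ ((s +ℚ u) *ℚ B) *ℚ i
  rearrange = solve-∀ᴿ ℚ-ring

sumℚ : List ℚ → ℚ
sumℚ = foldr _+ℚ_ 0ℚ

sumℚ-ℕtoℚ : ∀ {X : Set} (f : X → ℕ) xs → sumℚ (map (ℕtoℚ ∘ f) xs) ≡ ℕtoℚ (sum (map f xs))
sumℚ-ℕtoℚ f [] = refl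
sumℚ-ℕtoℚ f (x ∷ xs) = trans (cong (ℕtoℚ (f x) +ℚ_) (sumℚ-ℕtoℚ f xs)) (sym (ℕtoℚ-+ (f x) (sum (map f xs))))

sumℚ-nonNegative : ∀ qs → (∀ {q} → q ∈ qs → 0ℚ ≤ℚ q) → 0ℚ ≤ℚ sumℚ qs
sumℚ-nonNegative [] _ = ℚ.≤-refl
sumℚ-nonNegative (q ∷ qs) nonNeg =
  subst (_≤ℚ q +ℚ sumℚ qs) (ℚ.+-identityʳ 0ℚ) (ℚ.+-mono-≤ (nonNeg (here refl)) (sumℚ-nonNegative qs (nonNeg ∘ there)))

sumℚ-positive : ∀ qs → (∀ {q} → q ∈ qs → 0ℚ ≤ℚ q) → ∀ {q} → q ∈ qs → 0ℚ <ℚ q → 0ℚ <ℚ sumℚ qs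
sumℚ-positive (q ∷ qs) nonNeg (here refl) q>0 =
  subst (_<ℚ q +ℚ sumℚ qs) (ℚ.+-identityʳ 0ℚ) (ℚ.+-mono-<-≤ q>0 (sumℚ-nonNegative qs (nonNeg ∘ there)))
sumℚ-positive (q ∷ qs) nonNeg (there q′∈) q′>0 =
  subst (_<ℚ q +ℚ sumℚ qs) (ℚ.+-identityʳ 0ℚ)
        (ℚ.+-mono-≤-< (nonNeg (here refl)) (sumℚ-positive qs (nonNeg ∘ there) q′∈ q′>0))

sumᴾ : List Poly → Poly
sumᴾ = foldr _⊕_ []

eval-sumᴾ : ∀ ps x → eval (sumᴾ ps) x ≡ sumℚ (map (λ p → eval p x) ps)
eval-sumᴾ [] x = refl
eval-sumᴾ (p ∷ ps) x = trans (eval-⊕ p (sumᴾ ps) x) (cong (eval p x +ℚ_) (eval-sumᴾ ps x))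

coeff-sumᴾ : ∀ ps k → coeff (sumᴾ ps) k ≡ sumℚ (map (λ p → coeff p k) ps)
coeff-sumᴾ [] k = refl
coeff-sumᴾ (p ∷ ps) k = trans (coeff-⊕ p (sumᴾ ps) k) (cong (coeff p k +ℚ_) (coeff-sumᴾ ps k))

length-sumᴾ : ∀ ps {K} → (∀ {p} → p ∈ ps → length p ≤ K) → length (sumᴾ ps) ≤ K
length-sumᴾ [] _ = z≤n
length-sumᴾ (p ∷ ps) bounded = length-⊕ p (sumᴾ ps) (bounded (here refl)) (length-sumᴾ ps (bounded ∘ there))

toVec : ∀ K → Poly → Vec ℚ K
toVec K p = tabulate (coeff p ∘ toℕ)

evalPoly-toVec : ∀ K p x → length p ≤ K → evalPoly (toVec K p) x ≡ eval p x
evalPoly-toVec zero [] x _ = refl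
evalPoly-toVec (suc K) [] x _ =
  trans (cong (λ r → 0ℚ +ℚ x *ℚ r) (evalPoly-toVec K [] x z≤n)) (trans (ℚ.+-identityˡ _) (ℚ.*-zeroʳ x))
evalPoly-toVec (suc K) (a ∷ p) x (s≤s p≤K) = cong (λ r → a +ℚ x *ℚ r) (evalPoly-toVec K p x p≤K)

lookup-toVec-last : ∀ D p → lookup (toVec (suc D) p) (fromℕ D) ≡ coeff p D
lookup-toVec-last D p = trans (lookup∘tabulate (coeff p ∘ toℕ) (fromℕ D)) (cong (coeff p) (toℕ-fromℕ D))

-- There is no cancellation in degree D: every leading coefficient is positive.
binomialSum-polynomial : ∀ J D (es : List ℕ) → (∀ {e} → e ∈ es → e ≤ D) → D ∈ es →
  ∃ λ (c : Vec ℚ (suc D)) → lookup c (fromℕ D) ≢ 0ℚ ×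
    ∀ t → evalPoly c (ℕtoℚ (J + t)) ≡ ℕtoℚ (sum (map (λ e → binom e t) es))
binomialSum-polynomial J D es ≤D D∈es = toVec (suc D) P , leading≢0 , evaluation
  where
  P = sumᴾ (map (binomialPoly J) es)
  length-P : length P ≤ suc D
  length-P = length-sumᴾ (map (binomialPoly J) es) λ p∈ → let e , e∈ , eq = ∈-map⁻ (binomialPoly J) p∈ in
    subst (λ p → length p ≤ suc D) (sym eq) (≤-trans (length-binomialPoly J e) (s≤s (≤D e∈)))
  nonNegative : ∀ {q} → q ∈ map (λ e → coeff (binomialPoly J e) D) es → 0ℚ ≤ℚ q
  nonNegative q∈ with ∈-map⁻ (λ e → coeff (binomialPoly J e) D) q∈
  ... | e , e∈ , refl with m≤n⇒m<n∨m≡n (≤D e∈)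
  ...   | inj₁ e<D = ℚ.≤-reflexive (sym (coeff-length (binomialPoly J e) (≤-trans (length-binomialPoly J e) e<D)))
  ...   | inj₂ refl = ℚ.<⇒≤ (leading-binomialPoly J e)
  leading-positive : 0ℚ <ℚ coeff P D
  leading-positive = subst (0ℚ <ℚ_) (sym (trans (coeff-sumᴾ (map (binomialPoly J) es) D) (cong sumℚ (sym (map-∘ es)))))
    (sumℚ-positive _ nonNegative (∈-map⁺ (λ e → coeff (binomialPoly J e) D) D∈es) (leading-binomialPoly J D))
  leading≢0 : lookup (toVec (suc D) P) (fromℕ D) ≢ 0ℚ
  leading≢0 eq = ℚ.<-irrefl (sym (trans (sym (lookup-toVec-last D P)) eq)) leading-positive
  evaluation : ∀ t → evalPoly (toVec (suc D) P) (ℕtoℚ (J + t)) ≡ ℕtoℚ (sum (map (λ e → binom e t) es))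
  evaluation t = begin
    evalPoly (toVec (suc D) P) x                   ≡⟨ evalPoly-toVec (suc D) P x length-P ⟩
    eval P x                                       ≡⟨ eval-sumᴾ (map (binomialPoly J) es) x ⟩
    sumℚ (map (λ p → eval p x) (map (binomialPoly J) es))  ≡⟨ cong sumℚ (sym (map-∘ es)) ⟩
    sumℚ (map (λ e → eval (binomialPoly J e) x) es)        ≡⟨ cong sumℚ (map-cong (λ e → eval-binomialPoly J e t) es) ⟩
    sumℚ (map (λ e → ℕtoℚ (binom e t)) es)                 ≡⟨ sumℚ-ℕtoℚ (λ e → binom e t) es ⟩
    ℕtoℚ (sum (map (λ e → binom e t) es))                  ∎
    where
    open ≡-Reasoning
    x = ℕtoℚ (J + t)

-- Reachability

-- The sets of vertices reaching t within k steps grow inside [1, M], so they stabilise after at most M rounds.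
module Reachability {E : ℕ → ℕ → Set} (E? : ∀ i j → Dec (E i j)) {M t : ℕ} (t∈ : InRange M t)
                    (closed : ∀ {i j} → E i j → InRange M j → InRange M i) where

  Within : ℕ → ℕ → Set
  Within zero i = i ≡ t
  Within (suc k) i = i ≡ t ⊎ ∃ λ j → InRange M j × E i j × Within k j

  within? : ∀ k i → Dec (Within k i)
  within? zero i = i ≟ t
  within? (suc k) i = (i ≟ t) ⊎-dec ∃-inRange? (λ j → E? i j ×-dec within? k j) M

  within-inRange : ∀ {k i} → Within k i → InRange M i
  within-inRange {zero} refl = t∈
  within-inRange {suc k} (inj₁ refl) = t∈
  within-inRange {suc k} (inj₂ (j , j∈ , e , _)) = closed e j∈

  within⇒star : ∀ {k i} → Within k i → Star E i t
  within⇒star {zero} refl = ε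
  within⇒star {suc k} (inj₁ refl) = ε
  within⇒star {suc k} (inj₂ (j , _ , e , w)) = e ◅ within⇒star w

  star⇒within : ∀ {i} → Star E i t → ∃ λ k → Within k i
  star⇒within ε = zero , refl
  star⇒within (e ◅ s) with star⇒within s
  ... | k , w = suc k , inj₂ (_ , within-inRange w , e , w)

  within-suc : ∀ {k i} → Within k i → Within (suc k) i
  within-suc {zero} w = inj₁ w
  within-suc {suc k} (inj₁ eq) = inj₁ eq
  within-suc {suc k} (inj₂ (j , j∈ , e , w)) = inj₂ (j , j∈ , e , within-suc w)

  within-mono : ∀ {k k′ i} → k ≤ k′ → Within k i → Within k′ i
  within-mono {k} {k′} k≤k′ w with ≤⇒≤′ k≤k′
  ... | ≤′-refl = w
  ... | ≤′-step k≤′ = within-suc (within-mono (≤′⇒≤ k≤′) w)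

  Stable : ℕ → Set
  Stable k = ∀ {i} → InRange M i → Within (suc k) i → Within k i

  stable-suc : ∀ {k} → Stable k → Stable (suc k)
  stable-suc st _ (inj₁ eq) = inj₁ eq
  stable-suc st _ (inj₂ (j , j∈ , e , w)) = inj₂ (j , j∈ , e , st j∈ w)

  stable-+ : ∀ {k} → Stable k → ∀ b → Stable (b + k)
  stable-+ st zero = st
  stable-+ st (suc b) = stable-suc (stable-+ st b)

  stable⇒within : ∀ {k} → Stable k → ∀ b {i} → Within (b + k) i → Within k i
  stable⇒within st zero w = w
  stable⇒within st (suc b) w = stable⇒within st b (stable-+ st b (within-inRange w) w)

  stable-or-new : ∀ k → Stable k ⊎ ∃ λ i → InRange M i × Within (suc k) i × ¬ Within k i
  stable-or-new k with ∃-inRange? (λ i → within? (suc k) i ×-dec ¬? (within? k i)) M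
  ... | yes new = inj₂ new
  ... | no ¬new = inj₁ λ {i} i∈ w → Dec.decidable-stable (within? k i) (λ ¬w → ¬new (i , i∈ , w , ¬w))

  reached : ℕ → List ℕ
  reached k = filter (within? k) (oneTo M)

  reached-unique : ∀ k → Unique (reached k)
  reached-unique k = Unique.filter⁺ (within? k) (oneTo-unique M)

  ∈-reached : ∀ {k i} → i ∈ reached k ⇔ (InRange M i × Within k i)
  ∈-reached {k} = mk⇔ (λ i∈ → let i∈M , w = ∈-filter⁻ (within? k) {xs = oneTo M} i∈ in to ∈-oneTo i∈M , w)
                      (λ (i∈ , w) → ∈-filter⁺ (within? k) {xs = oneTo M} (from ∈-oneTo i∈) w)

  reached-length≤ : ∀ k → length (reached k) ≤ M
  reached-length≤ k = unique-inRange⇒length≤ (reached-unique k) (proj₁ ∘ to ∈-reached)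

  new⇒reached-grows : ∀ {k i} → InRange M i → Within (suc k) i → ¬ Within k i →
                      suc (length (reached k)) ≤ length (reached (suc k))
  new⇒reached-grows {k} {i} i∈ w ¬w = unique⊆⇒length≤ {xs = i ∷ reached k}
    (All.tabulate (λ j∈ → λ { refl → ¬w (proj₂ (to ∈-reached j∈)) }) ∷ reached-unique k)
    λ { (here refl) → from ∈-reached (i∈ , w)
      ; (there j∈) → let j∈M , wj = to ∈-reached j∈ in from ∈-reached (j∈M , within-suc wj) }

  stabilises : ∀ k → (∃ λ k′ → k′ ≤ k × Stable k′) ⊎ suc k ≤ length (reached k)
  stabilises zero = inj₂ (unique⊆⇒length≤ {xs = t ∷ []} (All.[] ∷ []) λ { (here refl) → from ∈-reached (t∈ , refl) })
  stabilises (suc k) with stabilises k | stable-or-new k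
  ... | inj₁ (k′ , k′≤k , st) | _ = inj₁ (k′ , m≤n⇒m≤1+n k′≤k , st)
  ... | inj₂ _ | inj₁ st = inj₁ (k , n≤1+n k , st)
  ... | inj₂ grown | inj₂ (i , i∈ , w , ¬w) = inj₂ (≤-trans (s≤s grown) (new⇒reached-grows i∈ w ¬w))

  within⇒within-M : ∀ {k i} → Within k i → Within M i
  within⇒within-M {k} {i} w with stabilises M
  ... | inj₂ M<len = contradiction (reached-length≤ M) (<⇒≱ M<len)
  ... | inj₁ (k′ , k′≤M , st) = within-mono k′≤M (stable⇒within st k (within-mono (m≤m+n k k′) w))

  star? : ∀ i → Dec (Star E i t)
  star? i = Dec.map′ within⇒star (λ s → within⇒within-M (proj₂ (star⇒within s))) (within? M i)

-- Permutations with inversion set S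

jS-upper : ∀ {S i j} → (i , j) ∈ S → j ≤ jS S
jS-upper {(_ , b) ∷ S} (here refl) = m≤m⊔n b (jS S)
jS-upper {(_ , b) ∷ S} (there p) = ≤-trans (jS-upper p) (m≤n⊔m b (jS S))

jS-least : ∀ S {n} → (∀ {i j} → (i , j) ∈ S → j ≤ n) → jS S ≤ n
jS-least [] _ = z≤n
jS-least ((a , b) ∷ S) bound = ⊔-lub (bound (here refl)) (jS-least S (bound ∘ there))

mS-upper : ∀ {S i} → (i , suc i) ∈ S → i ≤ mS S
mS-upper {(a , _) ∷ S} (here refl) with a ≡ᵇ a | ≡⇒≡ᵇ a a refl
... | true | _ = m≤m⊔n a (mS S)
mS-upper {(a , b) ∷ S} (there p) with b ≡ᵇ suc a
... | true = ≤-trans (mS-upper p) (m≤n⊔m a (mS S))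
... | false = mS-upper p

module Counting (h : ℕ → ℕ) (hs : IsHSeq h) (S : PairSet) where

  J : ℕ
  J = jS S

  InvPerm : ℕ → List ℕ → Set
  InvPerm n π = Perm n π × IsInvSet h n π S

  InP⇒inRange : ∀ {n i j} → InP h i j → j ≤ n → InRange n i × InRange n j
  InP⇒inRange (1≤i , i<j , _) j≤n = (1≤i , ≤-trans (<⇒≤ i<j) j≤n) , (≤-trans 1≤i (<⇒≤ i<j) , j≤n)

  module _ {n π} (p : Perm n π) (v : ℕ) where

    at-extend-inRange : ∀ {k} → InRange n k → at (extend π v) k ≡ bump v (at π k)
    at-extend-inRange k∈ = at-extend π v (inRange-length p k∈)

    invH-extend-old : ∀ {i j} → j ≤ n → InvH h (suc n) (extend π v) i j ⇔ InvH h n π i j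
    invH-extend-old {i} {j} j≤n = mk⇔
      (λ (inP , _ , lt) → inP , j≤n , bump-cancel-< v (subst₂ _<_ (at-j inP) (at-i inP) lt))
      (λ (inP , _ , lt) → inP , m≤n⇒m≤1+n j≤n , subst₂ _<_ (sym (at-j inP)) (sym (at-i inP)) (bump-mono-< v lt))
      where
      at-i = λ inP → at-extend-inRange (proj₁ (InP⇒inRange inP j≤n))
      at-j = λ inP → at-extend-inRange (proj₂ (InP⇒inRange inP j≤n))

    invH-extend-last : ∀ {i} → InvH h (suc n) (extend π v) i (suc n) ⇔ (InP h i (suc n) × v ≤ at π i)
    invH-extend-last {i} = mk⇔
      (λ (inP , _ , lt) → inP , to v<bump⇔v≤ (subst₂ _<_ last (at-extend-inRange (i∈ inP)) lt))
      (λ (inP , v≤) → inP , ≤-refl , subst₂ _<_ (sym last) (sym (at-extend-inRange (i∈ inP))) (from v<bump⇔v≤ v≤))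
      where
      last = at-extend-last π v (Perm-length p)
      i∈ : InP h i (suc n) → InRange n i
      i∈ (1≤i , i<1+n , _) = 1≤i , ≤-pred i<1+n

  Blocked : ℕ → ℕ → Set
  Blocked n i = InRange n i × suc n ≤ h i

  blocked : ℕ → List ℕ
  blocked n = filter (λ i → suc n ≤? h i) (oneTo n)

  ∈-blocked : ∀ {n i} → i ∈ blocked n ⇔ Blocked n i
  ∈-blocked {n} = mk⇔ (λ i∈ → let i∈n , b = ∈-filter⁻ (λ i → suc n ≤? h i) {xs = oneTo n} i∈ in to ∈-oneTo i∈n , b)
                      (λ (i∈ , b) → ∈-filter⁺ (λ i → suc n ≤? h i) {xs = oneTo n} (from ∈-oneTo i∈) b)

  -- The entries of π at blocked positions are exactly those that the new last entry must exceed.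
  threshold : ℕ → List ℕ → ℕ
  threshold n π = max 0 (map (at π) (blocked n))

  at≤threshold : ∀ {n} π {i} → Blocked n i → at π i ≤ threshold n π
  at≤threshold {n} π b = All.lookup (All.map⁻ (xs≤max 0 (map (at π) (blocked n)))) (from ∈-blocked b)

  threshold≤ : ∀ {n} π {b} → (∀ {i} → Blocked n i → at π i ≤ b) → threshold n π ≤ b
  threshold≤ π bound = max≤v⁺ z≤n (All.map⁺ (All.tabulate (bound ∘ to ∈-blocked)))

  threshold≤n : ∀ {n π} → Perm n π → threshold n π ≤ n
  threshold≤n {π = π} p = threshold≤ π (λ (i∈ , _) → proj₂ (Perm-at p i∈))

  threshold<⇔ : ∀ {n} π {v} → 1 ≤ v → threshold n π < v ⇔ (∀ {i} → Blocked n i → at π i < v)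
  threshold<⇔ π {suc v} _ = mk⇔ (λ thr<v {i} b → ≤-<-trans (at≤threshold π {i} b) thr<v)
                                (λ below → s≤s (threshold≤ π (λ {i} b → ≤-pred (below {i} b))))

  inv-extend : ∀ {n π v} → J ≤ n → Perm n π → InRange (suc n) v →
               IsInvSet h (suc n) (extend π v) S ⇔ (IsInvSet h n π S × threshold n π < v)
  inv-extend {n} {π} {v} J≤n p (1≤v , _) = mk⇔ restrict extend-inv
    where
    ∈S⇒≤n : ∀ {i j} → (i , j) ∈ S → j ≤ n
    ∈S⇒≤n ij∈S = ≤-trans (jS-upper ij∈S) J≤n
    -- A blocked entry ≥ v would give an inversion (i, n + 1) ∈ S, but S lives below J ≤ n.
    restrict : IsInvSet h (suc n) (extend π v) S → IsInvSet h n π S × threshold n π < v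
    restrict I = (λ i j → mk⇔ (λ ij∈S → to (invH-extend-old p v (∈S⇒≤n ij∈S)) (to (I i j) ij∈S))
                              (λ inv → from (I i j) (from (invH-extend-old p v (proj₁ (proj₂ inv))) inv))) ,
                 from (threshold<⇔ π 1≤v) below
      where
      below : ∀ {i} → Blocked n i → at π i < v
      below {i} ((1≤i , i≤n) , n<hi) with at π i <? v
      ... | yes lt = lt
      ... | no ≮ = let i,n+1∈S = from (I i (suc n)) (from (invH-extend-last p v) ((1≤i , s≤s i≤n , n<hi) , ≮⇒≥ ≮))
                   in contradiction (∈S⇒≤n i,n+1∈S) (<-irrefl refl)
    extend-inv : IsInvSet h n π S × threshold n π < v → IsInvSet h (suc n) (extend π v) S
    extend-inv (I , thr<v) i j = mk⇔
      (λ ij∈S → from (invH-extend-old p v (∈S⇒≤n ij∈S)) (to (I i j) ij∈S))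
      λ inv → case m≤n⇒m<n∨m≡n (proj₁ (proj₂ inv)) of λ where
        (inj₁ j≤n) → from (I i j) (to (invH-extend-old p v (≤-pred j≤n)) inv)
        (inj₂ refl) → let (1≤i , i<1+n , n<hi) , v≤ = to (invH-extend-last p v) inv in
          contradiction (to (threshold<⇔ π 1≤v) thr<v ((1≤i , ≤-pred i<1+n) , n<hi)) (≤⇒≯ v≤)

  threshold-extend : ∀ {n π v} → Perm n π → threshold n π < v → InRange (suc n) v →
                     threshold (suc n) (extend π v) ≡ v
  threshold-extend {n} {π} {v} p thr<v (1≤v , _) = ≤-antisym (threshold≤ (extend π v) below) last≤
    where
    last = at-extend-last π v (Perm-length p)
    below : ∀ {i} → Blocked (suc n) i → at (extend π v) i ≤ v
    below {i} ((1≤i , i≤1+n) , b) with m≤n⇒m<n∨m≡n i≤1+n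
    ... | inj₂ refl = ≤-reflexive last
    ... | inj₁ (s≤s i≤n) = let at<v = to (threshold<⇔ π 1≤v) thr<v {i} ((1≤i , i≤n) , ≤-trans (n≤1+n _) b) in
      <⇒≤ (subst (_< v) (sym (trans (at-extend-inRange p v (1≤i , i≤n)) (bump-< at<v))) at<v)
    last≤ : v ≤ threshold (suc n) (extend π v)
    last≤ = subst (_≤ threshold (suc n) (extend π v)) last
                  (at≤threshold (extend π v) {suc n} ((s≤s z≤n , ≤-refl) , proj₂ hs (suc n) (s≤s z≤n)))

  -- The number of admissible values for a new last entry, minus one.
  slack : ℕ → List ℕ → ℕ
  slack n π = n ∸ threshold n π

  freeValues : ℕ → List ℕ → List ℕ
  freeValues n π = map (λ w → suc (threshold n π + w)) (upTo (suc (slack n π)))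

  freeValues-unique : ∀ n π → Unique (freeValues n π)
  freeValues-unique n π = Unique.map⁺ (+-cancelˡ-≡ (threshold n π) _ _ ∘ suc-injective) (Unique.upTo⁺ _)

  ∈-freeValues : ∀ {n π v} → Perm n π → v ∈ freeValues n π ⇔ (InRange (suc n) v × threshold n π < v)
  ∈-freeValues {n} {π} {v} p = mk⇔ to′ from′
    where
    thr≤n = threshold≤n p
    to′ : v ∈ freeValues n π → InRange (suc n) v × threshold n π < v
    to′ v∈ with ∈-map⁻ _ v∈
    ... | w , w∈ , refl =
      (s≤s z≤n , s≤s (subst (threshold n π + w ≤_) (m+[n∸m]≡n thr≤n) (+-monoʳ-≤ _ (≤-pred (∈-upTo⁻ w∈))))) , s≤s (m≤m+n _ w)
    from′ : ∀ {u} → InRange (suc n) u × threshold n π < u → u ∈ freeValues n π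
    from′ {suc u} ((_ , s≤s u≤n) , s≤s thr≤u) =
      subst (_∈ freeValues n π) (cong suc (m+[n∸m]≡n thr≤u)) (∈-map⁺ _ (∈-upTo⁺ (s≤s (∸-monoˡ-≤ (threshold n π) u≤n))))

  invH? : ∀ n π i j → Dec (InvH h n π i j)
  invH? n π i j = (1 ≤? i ×-dec i <? j ×-dec j ≤? h i) ×-dec j ≤? n ×-dec at π j <? at π i

  isInvSet? : ∀ n π → Dec (IsInvSet h n π S)
  isInvSet? n π = Dec.map′ fromParts toParts
    (All.all? (λ (i , j) → invH? n π i j) S ×-dec
     All.all? (λ j → All.all? (λ i → invH? n π i j →-dec ((i , j) ∈ₚ? S)) (oneTo n)) (oneTo n))
    where
    fromParts : _ → IsInvSet h n π S
    fromParts (sound , complete) i j = mk⇔ (All.lookup sound) λ inv →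
      let i∈ , j∈ = InP⇒inRange (proj₁ inv) (proj₁ (proj₂ inv)) in
      All.lookup (All.lookup complete (from ∈-oneTo j∈)) (from ∈-oneTo i∈) inv
    toParts : IsInvSet h n π S → _
    toParts I = All.tabulate (λ {(i , j)} ij∈S → to (I i j) ij∈S) ,
                All.tabulate (λ {j} _ → All.tabulate (λ {i} _ → from (I i j)))

  invPerms : ℕ → List (List ℕ)
  invPerms zero = filter (isInvSet? J) (perms J)
  invPerms (suc t) = extensions (freeValues (t + J)) (invPerms t)

  invPerms-unique : ∀ t → Unique (invPerms t)
  invPerms-unique zero = Unique.filter⁺ (isInvSet? J) (perms-unique J)
  invPerms-unique (suc t) = extensions-unique _ (invPerms t) (invPerms-unique t) (freeValues-unique (t + J))

  ∈-invPerms : ∀ t {σ} → σ ∈ invPerms t ⇔ InvPerm (t + J) σ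
  ∈-invPerms zero = mk⇔ (λ σ∈ → let σ∈perms , I = ∈-filter⁻ (isInvSet? J) {xs = perms J} σ∈ in to ∈-perms σ∈perms , I)
                        (λ (p , I) → ∈-filter⁺ (isInvSet? J) {xs = perms J} (from ∈-perms p) I)
  ∈-invPerms (suc t) = mk⇔ to′ from′
    where
    J≤ = m≤n+m J t
    to′ : ∀ {σ} → σ ∈ invPerms (suc t) → InvPerm (suc t + J) σ
    to′ σ∈ with ∈-extensions⁻ _ (invPerms t) σ∈
    ... | π , v , π∈ , v∈ , refl with to (∈-invPerms t) π∈
    ...   | p , I with to (∈-freeValues p) v∈
    ...     | v∈′ , thr<v = Perm-extend p v∈′ , from (inv-extend J≤ p v∈′) (I , thr<v)
    from′ : ∀ {σ} → InvPerm (suc t + J) σ → σ ∈ invPerms (suc t)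
    from′ (pσ , Iσ) with Perm-unextend pσ
    ... | π , v , refl , p , v∈ with to (inv-extend J≤ p v∈) Iσ
    ...   | I , thr<v = ∈-extensions⁺ _ (invPerms t) (from (∈-invPerms t) (p , I)) (from (∈-freeValues p) (v∈ , thr<v))

  sum-freeValues : ∀ {n π} t → Perm n π →
                   sum (map (λ v → binom (slack (suc n) (extend π v)) t) (freeValues n π)) ≡ binom (slack n π) (suc t)
  sum-freeValues {n} {π} t p = begin
    sum (map (λ v → binom (slack (suc n) (extend π v)) t) (map value (upTo (suc (slack n π)))))
      ≡⟨ cong sum (sym (map-∘ (upTo (suc (slack n π))))) ⟩
    sum (map (λ w → binom (slack (suc n) (extend π (value w))) t) (upTo (suc (slack n π))))
      ≡⟨ cong sum (map-cong-local (All.tabulate (cong (λ e → binom e t) ∘ slack-value ∘ ≤-pred ∘ ∈-upTo⁻))) ⟩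
    sum (map (λ w → binom (slack n π ∸ w) t) (upTo (suc (slack n π))))
      ≡⟨ hockey-stick (slack n π) t ⟩
    binom (slack n π) (suc t) ∎
    where
    open ≡-Reasoning
    value = λ w → suc (threshold n π + w)
    slack-value : ∀ {w} → w ≤ slack n π → slack (suc n) (extend π (value w)) ≡ slack n π ∸ w
    slack-value {w} w≤ = begin
      suc n ∸ threshold (suc n) (extend π (value w))  ≡⟨ cong (suc n ∸_) (threshold-extend p thr<v v∈) ⟩
      n ∸ (threshold n π + w)                       ≡⟨ ∸-+-assoc n (threshold n π) w ⟨
      slack n π ∸ w                                 ∎
      where
      v∈,thr<v = to (∈-freeValues p) (∈-map⁺ value (∈-upTo⁺ (s≤s w≤)))
      v∈ = proj₁ v∈,thr<v
      thr<v = proj₂ v∈,thr<v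

  length-invPerms : ∀ t s → length (invPerms (t + s)) ≡ sum (map (λ π → binom (slack (s + J) π) t) (invPerms s))
  length-invPerms zero s = length≡sum1 (invPerms s)
    where
    length≡sum1 : ∀ (πs : List (List ℕ)) → length πs ≡ sum (map (λ π → binom (slack (s + J) π) 0) πs)
    length≡sum1 [] = refl
    length≡sum1 (π ∷ πs) = cong₂ _+_ (sym (binom-zero (slack (s + J) π))) (length≡sum1 πs)
  length-invPerms (suc t) s = begin
    length (invPerms (suc (t + s)))
      ≡⟨ cong (length ∘ invPerms) (sym (+-suc t s)) ⟩
    length (invPerms (t + suc s))
      ≡⟨ length-invPerms t (suc s) ⟩
    sum (map (λ σ → binom (slack (suc s + J) σ) t) (extensions (freeValues (s + J)) (invPerms s)))
      ≡⟨ sum-extensions _ (freeValues (s + J)) (invPerms s) ⟩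
    sum (map (λ π → sum (map (λ v → binom (slack (suc s + J) (extend π v)) t) (freeValues (s + J) π))) (invPerms s))
      ≡⟨ cong sum (map-cong-local (All.tabulate λ π∈ → sum-freeValues t (proj₁ (to (∈-invPerms s) π∈)))) ⟩
    sum (map (λ π → binom (slack (s + J) π) (suc t)) (invPerms s)) ∎
    where open ≡-Reasoning

  slacks : List ℕ
  slacks = map (slack J) (invPerms 0)

  length-invPerms≡binomialSum : ∀ t → length (invPerms t) ≡ sum (map (λ e → binom e t) slacks)
  length-invPerms≡binomialSum t = begin
    length (invPerms t)                                       ≡⟨ cong (length ∘ invPerms) (+-identityʳ t) ⟨
    length (invPerms (t + 0))                                 ≡⟨ length-invPerms t 0 ⟩
    sum (map (λ τ → binom (slack J τ) t) (invPerms 0))        ≡⟨ cong sum (map-∘ (invPerms 0)) ⟩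
    sum (map (λ e → binom e t) slacks)                        ∎
    where open ≡-Reasoning

  invPerms-hasCard : ∀ {n} → J ≤ n → HasCard (λ π → IsPerm n π × IsInvSet h n π S) (length (invPerms (n ∸ J)))
  invPerms-hasCard {n} J≤n = invPerms (n ∸ J) , invPerms-unique (n ∸ J) , members , refl
    where
    level = m∸n+n≡m J≤n
    members : ∀ π → π ∈ invPerms (n ∸ J) ⇔ (IsPerm n π × IsInvSet h n π S)
    members π = mk⇔ (λ π∈ → let p , I = subst (λ k → InvPerm k π) level (to (∈-invPerms (n ∸ J)) π∈) in Perm⇒isPerm p , I)
                    (λ (p , I) → from (∈-invPerms (n ∸ J)) (subst (λ k → InvPerm k π) (sym level) (isPerm⇒Perm p , I)))

  slack-restrict : ∀ {n σ} → J ≤ n → InvPerm (suc n) σ → ∃ λ π → InvPerm n π × slack (suc n) σ ≤ slack n π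
  slack-restrict {n} J≤n (pσ , Iσ) with Perm-unextend pσ
  ... | π , v , refl , p , v∈ with to (inv-extend J≤n p v∈) Iσ
  ...   | I , thr<v = π , (p , I) ,
          subst (λ t → suc n ∸ t ≤ slack n π) (sym (threshold-extend p thr<v v∈)) (∸-monoʳ-≤ (suc n) thr<v)

  slack-extend : ∀ {n π} → J ≤ n → InvPerm n π → ∃ λ σ → InvPerm (suc n) σ × slack (suc n) σ ≡ slack n π
  slack-extend {n} {π} J≤n (p , I) =
    extend π v , (Perm-extend p v∈ , from (inv-extend J≤n p v∈) (I , ≤-refl)) ,
    cong (suc n ∸_) (threshold-extend p ≤-refl v∈)
    where
    v = suc (threshold n π)
    v∈ = s≤s z≤n , s≤s (threshold≤n p)

  slack-extend-to : ∀ {n τ} → J ≤ n → InvPerm J τ → ∃ λ σ → InvPerm n σ × slack n σ ≡ slack J τ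
  slack-extend-to {n} {τ} J≤n a =
    subst (λ k → ∃ λ σ → InvPerm k σ × slack k σ ≡ slack J τ) (m∸n+n≡m J≤n) (iterate (n ∸ J))
    where
    iterate : ∀ k → ∃ λ σ → InvPerm (k + J) σ × slack (k + J) σ ≡ slack J τ
    iterate zero = τ , a , refl
    iterate (suc k) = let π , aπ , eq = iterate k ; σ , aσ , eq′ = slack-extend (m≤n+m J k) aπ in σ , aσ , trans eq′ eq

  slack-restrict-from : ∀ {n σ} → J ≤ n → InvPerm n σ → ∃ λ τ → InvPerm J τ × slack n σ ≤ slack J τ
  slack-restrict-from {n} {σ} J≤n a =
    let τ , aτ , ≤τ = iterate (n ∸ J) (subst (λ k → InvPerm k σ) (sym level) a)
    in τ , aτ , subst (λ k → slack k σ ≤ slack J τ) level ≤τ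
    where
    level = m∸n+n≡m J≤n
    iterate : ∀ k {σ} → InvPerm (k + J) σ → ∃ λ τ → InvPerm J τ × slack (k + J) σ ≤ slack J τ
    iterate zero {σ} a = σ , a , ≤-refl
    iterate (suc k) a = let π , aπ , ≤π = slack-restrict (m≤n+m J k) a ; τ , aτ , π≤ = iterate k aπ
                        in τ , aτ , ≤-trans ≤π π≤

-- The degree

-- rotate y x moves the value y up to x and shifts the values in (y, x] down by one.
rotate : ℕ → ℕ → ℕ → ℕ
rotate y x z with z ≟ y
... | yes _ = x
... | no _ = bump x (unbump y z)

module _ {y x : ℕ} (y<x : y < x) where

  rotate-y : rotate y x y ≡ x
  rotate-y with y ≟ y
  ... | yes _ = refl
  ... | no y≢y = contradiction refl y≢y

  rotate-≢ : ∀ {z} → z ≢ y → rotate y x z ≡ bump x (unbump y z)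
  rotate-≢ {z} z≢y with z ≟ y
  ... | yes z≡y = contradiction z≡y z≢y
  ... | no _ = refl

  rotate-injective : ∀ {z z′} → rotate y x z ≡ rotate y x z′ → z ≡ z′
  rotate-injective {z} {z′} eq with z ≟ y | z′ ≟ y
  ... | yes refl | yes refl = refl
  ... | yes _ | no _ = contradiction (sym eq) (bump≢ x _)
  ... | no _ | yes _ = contradiction eq (bump≢ x _)
  ... | no z≢y | no z′≢y = unbump-injective y z≢y z′≢y (bump-injective x eq)

  rotate-below : ∀ {z} → z < y → rotate y x z ≡ z
  rotate-below {z} z<y = trans (rotate-≢ (<⇒≢ z<y)) (trans (cong (bump x) (unbump-< z<y)) (bump-< (<-trans z<y y<x)))

  rotate-above : ∀ {z} → x < z → rotate y x z ≡ z
  rotate-above {suc z} (s≤s x≤z) =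
    trans (rotate-≢ (<⇒≢ y<z ∘ sym)) (trans (cong (bump x) (unbump-> y<z)) (bump-≥ x≤z))
    where y<z = <-trans y<x (s≤s x≤z)

  rotate-between : ∀ {z} → y < z → z ≤ x → rotate y x z ≡ pred z
  rotate-between {suc z} y<z z<x = trans (rotate-≢ (<⇒≢ y<z ∘ sym)) (trans (cong (bump x) (unbump-> y<z)) (bump-< z<x))

  rotate-inRange : ∀ {M z} → 1 ≤ y → x ≤ M → InRange M z → InRange M (rotate y x z)
  rotate-inRange {M} {z} 1≤y x≤M z∈@(_ , z≤M) with <-cmp z y
  ... | tri< z<y _ _ = subst (InRange M) (sym (rotate-below z<y)) z∈
  ... | tri≈ _ refl _ = subst (InRange M) (sym rotate-y) (≤-trans 1≤y (<⇒≤ y<x) , x≤M)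
  ... | tri> _ _ y<z with x <? z
  ...   | yes x<z = subst (InRange M) (sym (rotate-above x<z)) z∈
  ...   | no x≮z = subst (InRange M) (sym (rotate-between y<z (≮⇒≥ x≮z))) (pred-≥1 y<z , ≤-trans pred[n]≤n z≤M)
    where
    pred-≥1 : ∀ {z} → y < z → 1 ≤ pred z
    pred-≥1 {suc z} (s≤s y≤z) = ≤-trans 1≤y y≤z

  rotate-mono-< : ∀ {p q} → p < q → (p ≡ y → x < q) → rotate y x p < rotate y x q
  rotate-mono-< {p} {q} p<q straddle = case ((p ≟ y) ,′ (q ≟ y)) of λ where
    (yes refl , _) → subst₂ _<_ (sym rotate-y) (sym (rotate-above (straddle refl))) (straddle refl)
    (no _ , yes refl) → subst₂ _<_ (sym (rotate-below p<q)) (sym rotate-y) (<-trans p<q y<x)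
    (no p≢y , no q≢y) → subst₂ _<_ (sym (rotate-≢ p≢y)) (sym (rotate-≢ q≢y)) (bump-mono-< x (unbump-mono-< y p≢y q≢y p<q))

  rotate-<⇔ : ∀ {p q} → (p ≡ y → ¬ (y < q × q ≤ x)) → (q ≡ y → ¬ (y < p × p ≤ x)) →
              p < q ⇔ rotate y x p < rotate y x q
  rotate-<⇔ {p} {q} p-ok q-ok = mk⇔
    (λ p<q → rotate-mono-< p<q (λ { refl → ≰⇒> λ q≤x → p-ok refl (p<q , q≤x) }))
    λ ρp<ρq → case <-cmp p q of λ where
      (tri< p<q _ _) → p<q
      (tri≈ _ refl _) → contradiction ρp<ρq (<-irrefl refl)
      (tri> _ _ q<p) → contradiction (rotate-mono-< q<p (λ { refl → ≰⇒> λ p≤x → q-ok refl (q<p , p≤x) })) (<-asym ρp<ρq)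

module Degree (h : ℕ → ℕ) (hs : IsHSeq h) (S : PairSet) (nonempty : Nonempty S) (admissible : Admissible h S) where
  open Counting h hs S

  h-mono : ∀ {i j} → 1 ≤ i → i ≤ j → h i ≤ h j
  h-mono = proj₁ hs _ _
  h-> : ∀ {i} → 1 ≤ i → i < h i
  h-> = proj₂ hs _

  m M : ℕ
  m = mS S
  M = h m

  private
    n₀ = proj₁ admissible
    π₀ = proj₁ (proj₂ admissible)
    π₀-inv : IsInvSet h n₀ π₀ S
    π₀-inv = proj₂ (proj₂ (proj₂ admissible))
    π₀-invPerm : InvPerm n₀ π₀
    π₀-invPerm = isPerm⇒Perm (proj₁ (proj₂ (proj₂ admissible))) , π₀-inv

  ∈S⇒InvH : ∀ {i j} → (i , j) ∈ S → InvH h n₀ π₀ i j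
  ∈S⇒InvH = to (π₀-inv _ _)

  -- An inversion (a, b) of π₀ contains an adjacent descent (k, k + 1) with a ≤ k, which lies in S.
  ∈S⇒≤m : ∀ {a b} → (a , b) ∈ S → a ≤ m
  ∈S⇒≤m ab∈S with ∈S⇒InvH ab∈S
  ... | (1≤a , a<b , _) , b≤n₀ , desc with descent-between (at π₀) a<b desc
  ...   | k , a≤k , k<b , desc′ =
    ≤-trans a≤k (mS-upper (from (π₀-inv k (suc k)) ((1≤k , ≤-refl , h-> 1≤k) , ≤-trans k<b b≤n₀ , desc′)))
    where 1≤k = ≤-trans 1≤a a≤k

  1≤m : 1 ≤ m
  1≤m = let _ , ij∈S = nonempty in ≤-trans (proj₁ (proj₁ (∈S⇒InvH ij∈S))) (∈S⇒≤m ij∈S)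

  m<M : m < M
  m<M = h-> 1≤m

  1≤M : 1 ≤ M
  1≤M = ≤-trans 1≤m (<⇒≤ m<M)

  ∈S⇒≤M : ∀ {a b} → (a , b) ∈ S → b ≤ M
  ∈S⇒≤M ab∈S = let (1≤a , _ , b≤ha) , _ = ∈S⇒InvH ab∈S in ≤-trans b≤ha (h-mono 1≤a (∈S⇒≤m ab∈S))

  J≤M : J ≤ M
  J≤M = jS-least S ∈S⇒≤M

  J≤n₀ : J ≤ n₀
  J≤n₀ = jS-least S (proj₁ ∘ proj₂ ∘ ∈S⇒InvH)

  invPerm-exists : ∀ n → J ≤ n → ∃ (InvPerm n)
  invPerm-exists n J≤n = let τ , aτ , _ = slack-restrict-from J≤n₀ π₀-invPerm ; σ , aσ , _ = slack-extend-to J≤n aτ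
                         in σ , aσ

  step? : ∀ i j → Dec (Step h S M i j)
  step? i j with (j , i) ∈ₚ? S
  ... | yes ji∈S = yes (fromS ji∈S)
  ... | no ji∉S with (1 ≤? i ×-dec i <? j ×-dec j ≤? h i) ×-dec ¬? ((i , j) ∈ₚ? S) ×-dec j ≤? M
  ...   | yes (inP , ij∉S , j≤M) = yes (fromNotS inP ij∉S j≤M)
  ...   | no ¬step = no λ { (fromS ji∈S) → ji∉S ji∈S ; (fromNotS inP ij∉S j≤M) → ¬step (inP , ij∉S , j≤M) }

  step-closed : ∀ {i j} → Step h S M i j → InRange M j → InRange M i
  step-closed (fromS ji∈S) _ = let (1≤j , j<i , _) , _ = ∈S⇒InvH ji∈S in ≤-trans 1≤j (<⇒≤ j<i) , ∈S⇒≤M ji∈S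
  step-closed (fromNotS (1≤i , i<j , _) _ j≤M) _ = 1≤i , ≤-trans (<⇒≤ i<j) j≤M

  open Reachability step? (1≤M , ≤-refl) step-closed using (star?)

  downSet : List ℕ
  downSet = filter star? (oneTo M)

  ∈-downSet : ∀ {i} → i ∈ downSet ⇔ (1 ≤ i × i ≤ M × i ≤[ h , S , M ] M)
  ∈-downSet = mk⇔ (λ i∈ → let i∈M , i≤ₛM = ∈-filter⁻ star? {xs = oneTo M} i∈ ; 1≤i , i≤M = to ∈-oneTo i∈M in 1≤i , i≤M , i≤ₛM)
                  (λ (1≤i , i≤M , i≤ₛM) → ∈-filter⁺ star? {xs = oneTo M} (from ∈-oneTo (1≤i , i≤M)) i≤ₛM)

  downSet-unique : Unique downSet
  downSet-unique = Unique.filter⁺ star? (oneTo-unique M)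

  d : ℕ
  d = length downSet

  downSet-hasCard : HasCard (λ i → 1 ≤ i × i ≤ M × i ≤[ h , S , M ] M) d
  downSet-hasCard = downSet , downSet-unique , (λ _ → ∈-downSet) , refl

  step⇒at≤ : ∀ {n σ i j} → M ≤ n → InvPerm n σ → Step h S M i j → at σ i ≤ at σ j
  step⇒at≤ _ (_ , I) (fromS ji∈S) = <⇒≤ (proj₂ (proj₂ (to (I _ _) ji∈S)))
  step⇒at≤ {σ = σ} {i} {j} M≤n (_ , I) (fromNotS inP ij∉S j≤M) with at σ j <? at σ i
  ... | yes inverted = contradiction (from (I i j) (inP , ≤-trans j≤M M≤n , inverted)) ij∉S
  ... | no ≮ = ≮⇒≥ ≮

  ≤ₛ⇒at≤ : ∀ {n σ i j} → M ≤ n → InvPerm n σ → i ≤[ h , S , M ] j → at σ i ≤ at σ j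
  ≤ₛ⇒at≤ M≤n a ε = ≤-refl
  ≤ₛ⇒at≤ M≤n a (s ◅ ss) = ≤-trans (step⇒at≤ M≤n a s) (≤ₛ⇒at≤ M≤n a ss)

  downSet-inRange : ∀ {i} → i ∈ downSet → InRange M i
  downSet-inRange i∈ = let 1≤i , i≤M , _ = to ∈-downSet i∈ in 1≤i , i≤M

  -- The entries of σ at the d positions i ≤ₛ M are distinct and at most σ_M.
  d≤at-M : ∀ {σ} → InvPerm M σ → d ≤ at σ M
  d≤at-M {σ} a@(p , _) = subst (_≤ at σ M) (length-map (at σ) downSet)
    (unique-inRange⇒length≤ (unique-map⁺-injectiveOn (Perm-at-injective p) (All.tabulate downSet-inRange) downSet-unique)
                            below)
    where
    below : ∀ {x} → x ∈ map (at σ) downSet → InRange (at σ M) x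
    below x∈ with ∈-map⁻ (at σ) x∈
    ... | i , i∈ , refl = proj₁ (Perm-at p (downSet-inRange i∈)) , ≤ₛ⇒at≤ ≤-refl a (proj₂ (proj₂ (to ∈-downSet i∈)))

  above-m⇒≤ₛM : ∀ {i} → m < i → i ≤ M → i ≤[ h , S , M ] M
  above-m⇒≤ₛM {i} m<i i≤M = chain (M ∸ i) m<i (m+[n∸m]≡n i≤M)
    where
    chain : ∀ k {i} → m < i → i + k ≡ M → i ≤[ h , S , M ] M
    chain zero {i} _ i+0≡M = subst (_≤[ h , S , M ] M) (sym (trans (sym (+-identityʳ i)) i+0≡M)) ε
    chain (suc k) {i} m<i i+k+1≡M =
      fromNotS (1≤i , ≤-refl , h-> 1≤i) (λ i,i+1∈S → <⇒≱ m<i (mS-upper i,i+1∈S)) (subst (suc i ≤_) i+k+1≡M (m<m+n i (s≤s z≤n)))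
      ◅ chain k (m<n⇒m<1+n m<i) (trans (sym (+-suc i k)) i+k+1≡M)
      where 1≤i = ≤-trans (s≤s z≤n) m<i

  -- Positions blocked at level M lie beyond m, hence below M in ≤ₛ.
  threshold-M : ∀ {σ} → InvPerm M σ → threshold M σ ≡ at σ M
  threshold-M {σ} a = ≤-antisym (threshold≤ σ blocked≤) (at≤threshold σ ((1≤M , ≤-refl) , h-> 1≤M))
    where
    blocked≤ : ∀ {i} → Blocked M i → at σ i ≤ at σ M
    blocked≤ ((1≤i , i≤M) , M<hi) = ≤ₛ⇒at≤ ≤-refl a (above-m⇒≤ₛM (≰⇒> λ i≤m → <⇒≱ M<hi (h-mono 1≤i i≤m)) i≤M)

  OutsideValue : List ℕ → ℕ → Set
  OutsideValue σ y = ∃ λ q → InRange M q × at σ q ≡ y × q ∉ downSet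

  outsideValue? : ∀ σ y → Dec (OutsideValue σ y)
  outsideValue? σ y = ∃-inRange? (λ q → (at σ q ≟ y) ×-dec ¬? (q ∈ℕ? downSet)) M

  module _ {σ} (a : InvPerm M σ) where
    private
      p = proj₁ a
      I = proj₂ a
      x = at σ M
      M∈ : InRange M M
      M∈ = 1≤M , ≤-refl

    in-downSet : ∀ {i} → InRange M i → ¬ OutsideValue σ (at σ i) → i ∈ downSet
    in-downSet {i} i∈ ¬outside with i ∈ℕ? downSet
    ... | yes i∈D = i∈D
    ... | no i∉D = contradiction (i , i∈ , refl , i∉D) ¬outside

    -- If every value below σ_M sits inside the down-set, then [1, σ_M] ⊆ σ(down-set).
    no-outside⇒at-M≤d : (∀ {y} → y < x → ¬ OutsideValue σ y) → x ≤ d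
    no-outside⇒at-M≤d none = subst₂ _≤_ (length-oneTo x) (length-map (at σ) downSet)
      (unique⊆⇒length≤ (oneTo-unique x) covered)
      where
      covered : ∀ {w} → w ∈ oneTo x → w ∈ map (at σ) downSet
      covered w∈ with to ∈-oneTo w∈
      ... | 1≤w , w≤x with ∈⇒at σ (from (proj₂ p) (1≤w , ≤-trans w≤x (proj₂ (Perm-at p M∈))))
      ...   | i , i∈′ , refl = ∈-map⁺ (at σ) (case m≤n⇒m<n∨m≡n w≤x of λ where
              (inj₁ w<x) → in-downSet i∈ (none w<x)
              (inj₂ σi≡x) → subst (_∈ downSet) (sym (Perm-at-injective p i∈ M∈ σi≡x)) (from ∈-downSet (1≤M , ≤-refl , ε)))
        where i∈ = let 1≤i , i≤ = i∈′ in 1≤i , subst (i ≤_) (Perm-length p) i≤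

    module _ {y q} (y<x : y < x) (q∈ : InRange M q) (σq≡y : at σ q ≡ y) (q∉ : q ∉ downSet)
             (largest : ∀ {z} → y < z → z < x → ¬ OutsideValue σ z) where

      private
        σ′ = map (rotate y x) σ
        1≤y = subst (1 ≤_) σq≡y (proj₁ (Perm-at p q∈))

      q≰ₛM : ¬ q ≤[ h , S , M ] M
      q≰ₛM q≤ₛM = q∉ (from ∈-downSet (proj₁ q∈ , proj₂ q∈ , q≤ₛM))

      between⇒≤ₛM : ∀ {i} → InRange M i → y < at σ i → at σ i ≤ x → i ≤[ h , S , M ] M
      between⇒≤ₛM {i} i∈ y<σi σi≤x = case m≤n⇒m<n∨m≡n σi≤x of λ where
        (inj₁ σi<x) → proj₂ (proj₂ (to ∈-downSet (in-downSet i∈ (largest y<σi σi<x))))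
        (inj₂ σi≡x) → subst (_≤[ h , S , M ] M) (sym (Perm-at-injective p i∈ M∈ σi≡x)) ε

      is-q : ∀ {i} → InRange M i → at σ i ≡ y → i ≡ q
      is-q i∈ σi≡y = Perm-at-injective p i∈ q∈ (trans σi≡y (sym σq≡y))

      σ′-perm : Perm M σ′
      σ′-perm = unique-inRange⇒Perm (Unique.map⁺ (rotate-injective y<x) (proj₁ p)) (trans (length-map _ σ) (Perm-length p))
        λ z∈ → let w , w∈ , eq = ∈-map⁻ (rotate y x) z∈ in
               subst (InRange M) (sym eq) (rotate-inRange y<x 1≤y (proj₂ (Perm-at p M∈)) (to (proj₂ p) w∈))

      at-σ′ : ∀ {k} → InRange M k → at σ′ k ≡ rotate y x (at σ k)
      at-σ′ k∈ = at-map (rotate y x) σ (inRange-length p k∈)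

      -- A straddling pair would put q below M: (i, j) ∉ S gives q = i <ₛ j, and (i, j) ∈ S gives q = j <ₛ i.
      inversions-preserved : ∀ {i j} → InP h i j → j ≤ M → at σ j < at σ i ⇔ at σ′ j < at σ′ i
      inversions-preserved {i} {j} inP j≤M =
        subst₂ (λ u v → at σ j < at σ i ⇔ u < v) (sym (at-σ′ j∈)) (sym (at-σ′ i∈)) (rotate-<⇔ y<x j-ok i-ok)
        where
        i∈ = proj₁ (InP⇒inRange inP j≤M)
        j∈ = proj₂ (InP⇒inRange inP j≤M)
        j-ok : at σ j ≡ y → ¬ (y < at σ i × at σ i ≤ x)
        j-ok σj≡y (y<σi , σi≤x) = q≰ₛM (subst (_≤[ h , S , M ] M) (is-q j∈ σj≡y)
          (fromS (from (I i j) (inP , j≤M , subst (_< at σ i) (sym σj≡y) y<σi)) ◅ between⇒≤ₛM i∈ y<σi σi≤x))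
        i-ok : at σ i ≡ y → ¬ (y < at σ j × at σ j ≤ x)
        i-ok σi≡y (y<σj , σj≤x) with (i , j) ∈ₚ? S
        ... | yes ij∈S = <-asym (proj₂ (proj₂ (to (I i j) ij∈S))) (subst (_< at σ j) (sym σi≡y) y<σj)
        ... | no ij∉S = q≰ₛM (subst (_≤[ h , S , M ] M) (is-q i∈ σi≡y) (fromNotS inP ij∉S j≤M ◅ between⇒≤ₛM j∈ y<σj σj≤x))

      rotated : ∃ λ σ′ → InvPerm M σ′ × at σ′ M ≡ pred x
      rotated = σ′ , (σ′-perm , λ i j → mk⇔
        (λ ij∈S → let inP , j≤M , inv = to (I i j) ij∈S in inP , j≤M , to (inversions-preserved inP j≤M) inv)
        (λ (inP , j≤M , inv′) → from (I i j) (inP , j≤M , from (inversions-preserved inP j≤M) inv′))) ,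
        trans (at-σ′ M∈) (rotate-between y<x y<x ≤-refl)

    rotate-down : d < x → ∃ λ σ′ → InvPerm M σ′ × at σ′ M ≡ pred x
    rotate-down d<x with largest-below (outsideValue? σ) x
    ... | inj₂ none = contradiction (no-outside⇒at-M≤d none) (<⇒≱ d<x)
    ... | inj₁ (y , y<x , (q , q∈ , σq≡y , q∉) , largest) = rotated y<x q∈ σq≡y q∉ largest

  minimal-at-M : ∃ λ σ → InvPerm M σ × at σ M ≤ d
  minimal-at-M = let σ , a = invPerm-exists M J≤M in descend (at σ M) a refl
    where
    descend : ∀ x {σ} → InvPerm M σ → at σ M ≡ x → ∃ λ σ → InvPerm M σ × at σ M ≤ d
    descend zero {σ} a σM≡0 = σ , a , subst (_≤ d) (sym σM≡0) z≤n
    descend (suc x) {σ} a σM≡x with at σ M ≤? d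
    ... | yes σM≤d = σ , a , σM≤d
    ... | no σM≰d = let σ′ , a′ , eq = rotate-down a (≰⇒> σM≰d) in descend x a′ (trans eq (cong pred σM≡x))

  slack-M : ∀ {σ} → InvPerm M σ → slack M σ ≡ M ∸ at σ M
  slack-M a = cong (M ∸_) (threshold-M a)

  slack≤M∸d : ∀ {τ} → InvPerm J τ → slack J τ ≤ M ∸ d
  slack≤M∸d a with slack-extend-to J≤M a
  ... | σ , aσ , eq = subst (_≤ M ∸ d) (trans (sym (slack-M aσ)) eq) (∸-monoʳ-≤ M (d≤at-M aσ))

  slack≡M∸d : ∃ λ τ → InvPerm J τ × slack J τ ≡ M ∸ d
  slack≡M∸d with minimal-at-M
  ... | σ , aσ , σM≤d with slack-restrict-from J≤M aσ
  ...   | τ , aτ , ≤τ =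
    τ , aτ , ≤-antisym (slack≤M∸d aτ) (≤-trans (∸-monoʳ-≤ M σM≤d) (subst (_≤ slack J τ) (slack-M aσ) ≤τ))

  slacks≤M∸d : ∀ {e} → e ∈ slacks → e ≤ M ∸ d
  slacks≤M∸d e∈ = let τ , τ∈ , e≡ = ∈-map⁻ (slack J) e∈ in subst (_≤ M ∸ d) (sym e≡) (slack≤M∸d (to (∈-invPerms 0) τ∈))

  M∸d∈slacks : M ∸ d ∈ slacks
  M∸d∈slacks = let τ , aτ , eq = slack≡M∸d in subst (_∈ slacks) eq (∈-map⁺ (slack J) (from (∈-invPerms 0) aτ))

corollary4p13 : (h : ℕ → ℕ) → IsHSeq h → (S : PairSet) → Nonempty S → Admissible h S →
    ∃ λ (d : ℕ) →
      HasCard (λ i → 1 ≤ i × i ≤ h (mS S) × i ≤[ h , S , h (mS S) ] h (mS S)) d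
      × ∃ λ (c : Vec ℚ (suc (h (mS S) ∸ d))) →
          lookup c (fromℕ (h (mS S) ∸ d)) ≢ 0ℚ
          × (∀ (n : ℕ) → jS S ≤ n →
               ∃ λ (k : ℕ) →
                 HasCard (λ (π : List ℕ) → IsPerm n π × IsInvSet h n π S) k
                 × evalPoly c (ℕtoℚ n) ≡ ℕtoℚ k)
corollary4p13 h hs S nonempty admissible =
  d , downSet-hasCard , c , leading≢0 , λ n J≤n → length (invPerms (n ∸ J)) , invPerms-hasCard J≤n , counts n J≤n
  where
  open Counting h hs S
  open Degree h hs S nonempty admissible
  polynomial = binomialSum-polynomial J (M ∸ d) slacks slacks≤M∸d M∸d∈slacks
  c = proj₁ polynomial
  leading≢0 = proj₁ (proj₂ polynomial)
  counts : ∀ n → J ≤ n → evalPoly c (ℕtoℚ n) ≡ ℕtoℚ (length (invPerms (n ∸ J)))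
  counts n J≤n = begin
    evalPoly c (ℕtoℚ n)                                  ≡⟨ cong (evalPoly c ∘ ℕtoℚ) (m+[n∸m]≡n J≤n) ⟨
    evalPoly c (ℕtoℚ (J + (n ∸ J)))                      ≡⟨ proj₂ (proj₂ polynomial) (n ∸ J) ⟩
    ℕtoℚ (sum (map (λ e → binom e (n ∸ J)) slacks))      ≡⟨ cong ℕtoℚ (length-invPerms≡binomialSum (n ∸ J)) ⟨
    ℕtoℚ (length (invPerms (n ∸ J)))                     ∎
    where open ≡-Reasoning
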